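{- (1) Let $p$ be an odd prime, $n$ a positive integer and $\frac{a}{p^n}$ an irreducible fraction. Then the following are equivalent: $\mathcal{S}_{\frac{a}{p^n}}(q)$ is palindromic; $a\equiv\pm1\pmod{p^n}$; $\mathcal{S}_{\frac{a}{p^n}}(q)=[p^n]_q=1+q+\cdots+q^{p^n-1}$. (2) Let $n\ge 2$ and let $\frac{a}{2^n}$ be an irreducible fraction. Then $\mathcal{S}_{\frac{a}{2^n}}(q)$ is palindromic if and only if $a\equiv\pm1\pmod{2^n}$ or $a\equiv 2^{n-1}\pm1\pmod{2^n}$.
   Context: For an integer $c$, $[c]_q=\frac{1-q^c}{1-q}$. Every rational $\alpha>1$ has a unique negative continued fraction expansion $\alpha=c_1-\cfrac{1}{c_2-\cfrac{1}{\ddots-\cfrac{1}{c_l}}}$ with integers $c_j\ge 2$. Put $M^-_q(c)=\begin{pmatrix}[c]_q & -q^{c-1}\\ 1 & 0\end{pmatrix}$ and define $\mathcal{R}_\alpha(q),\mathcal{S}_\alpha(q)$ by $\begin{pmatrix}\mathcal{R}_\alpha(q)\\ \mathcal{S}_\alpha(q)\end{pmatrix}=M^-_q(c_1)\cdots M^-_q(c_l)\begin{pmatrix}1\\0\end{pmatrix}$. For rational $\alpha\le 1$ these are defined recursively by $\mathcal{S}_\alpha(q)=\mathcal{S}_{\alpha+1}(q)$ and $\mathcal{R}_\alpha(q)=q^{ -1}(\mathcal{R}_{\alpha+1}(q)-\mathcal{S}_{\alpha+1}(q))$. A polynomial $f$ is palindromic if $q^{\deg f}f(q^{ -1})=f(q)$.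 An irreducible fraction $\frac{r}{s}$ means $\gcd(r,s)=1$, $s>0$. -}

module Defs where

open import Data.Nat as ℕ using (ℕ; zero; suc; _∸_; _≡ᵇ_; _<ᵇ_)
open import Data.Nat.DivMod using (_/_)
open import Data.Integer as ℤ using (ℤ; +_; -[1+_]; ∣_∣)
open import Data.List using (List; []; _∷_; replicate; reverse)
open import Data.Product using (_×_; _,_; proj₁; proj₂)
open import Data.Bool using (Bool; true; false; if_then_else_)
open import Relation.Binary.PropositionalEquality using (_≡_)

-- Polynomials in q with integer coefficients, as coefficient lists,
-- lowest degree first.  Trailing zeros are allowed; equality of
-- polynomials is equality after stripping trailing zeros.

Poly : Set
Poly = List ℤ

_+P_ : Poly → Poly → Poly
[] +P g = g
(x ∷ f) +P [] = x ∷ f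
(x ∷ f) +P (y ∷ g) = (x ℤ.+ y) ∷ (f +P g)

negP : Poly → Poly
negP [] = []
negP (x ∷ f) = (ℤ.- x) ∷ negP f

scaleP : ℤ → Poly → Poly
scaleP c [] = []
scaleP c (x ∷ f) = (c ℤ.* x) ∷ scaleP c f

_*P_ : Poly → Poly → Poly
[] *P g = []
(x ∷ f) *P g = scaleP x g +P (+ 0 ∷ (f *P g))

shiftP : ℕ → Poly → Poly
shiftP zero f = f
shiftP (suc k) f = + 0 ∷ shiftP k f

isZeroℤ : ℤ → Bool
isZeroℤ (+ zero) = true
isZeroℤ _ = false

strip : Poly → Poly
strip [] = []
strip (x ∷ f) with strip f
... | [] = if isZeroℤ x then [] else x ∷ []
... | y ∷ g = x ∷ y ∷ g

_≈P_ : Poly → Poly → Set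
f ≈P g = strip f ≡ strip g

-- palindromic: q^{deg f} f(q^{-1}) = f(q), i.e. the (stripped)
-- coefficient list equals its reverse.
Palindromic : Poly → Set
Palindromic f = reverse (strip f) ≡ strip f

qint : ℕ → Poly
qint c = replicate c (+ 1)

-- Negative continued fraction of r/s (r > s > 0, gcd(r,s)=1):
-- c₁ = ⌈r/s⌉; if s ∣ r it stops, otherwise continue with
-- s / (c₁ s - r).  The first argument is fuel; fuel = s suffices
-- because the denominators strictly decrease.

ncf : ℕ → ℕ → ℕ → List ℕ
ncf zero r s = []
ncf (suc f) r zero = []
ncf (suc f) r (suc s′) =
  let c = (r ℕ.+ s′) / suc s′ in
  if c ℕ.* suc s′ ≡ᵇ r then c ∷ []
  else c ∷ ncf f (suc s′) (c ℕ.* suc s′ ∸ r)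

negCF : ℕ → ℕ → List ℕ
negCF r s = ncf s r s

-- M⁻_q(c₁) ⋯ M⁻_q(c_l) (1,0)ᵀ, with M⁻_q(c) = [[ [c]_q , -q^{c-1} ], [1 , 0]]
RSvec : List ℕ → Poly × Poly
RSvec [] = (+ 1 ∷ []) , []
RSvec (c ∷ cs) with RSvec cs
... | (R , S) = ((qint c *P R) +P negP (shiftP (c ∸ 1) S)) , R

S>1 : ℕ → ℕ → Poly
S>1 r s = proj₂ (RSvec (negCF r s))

-- S_{a/s} for arbitrary integer a and s > 0:
-- if a/s > 1 use the continued fraction, otherwise S_{a/s} = S_{(a+s)/s}.
-- (fuel ∣a∣ + 2 is enough to reach a/s > 1)
Sfuel : ℕ → ℤ → ℕ → Poly
Sfuel zero a s = []
Sfuel (suc f) (+ r) s = if s <ᵇ r then S>1 r s else Sfuel f (+ r ℤ.+ + s) s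
Sfuel (suc f) -[1+ r ] s = Sfuel f (-[1+ r ] ℤ.+ + s) s

𝒮 : ℤ → ℕ → Poly
𝒮 a s = Sfuel (∣ a ∣ ℕ.+ 2) a s

-- At q = 1 the matrices M⁻_q(c) become the integer matrices [[c, −1], [1, 0]] of determinant 1, and along
-- the continued fraction one can track, besides the values R(1), S(1) = m, also the derivatives R′(1), S′(1).
-- A palindromic S of degree d satisfies 2 S′(1) = d S(1); compared with the tracked formula this yields a
-- congruence modulo m between entries of the integer product matrix which, by the determinant identity,
-- reads a² ≡ 1 (mod m).  Modulo pⁿ (p odd) this leaves a ≡ ±1, modulo 2ⁿ also a ≡ 2ⁿ⁻¹ ± 1.
-- Conversely, the expansion of a/m continues after one step with m/t where t ≡ −a (mod m), and 𝒮_{a/m} is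
-- ℛ_{m/t}.  For a ≡ 1, −1, 2ⁿ⁻¹ − 1, 2ⁿ⁻¹ + 1 the word of m/t is [2, …, 2], [m], [2, 2ⁿ⁻² + 1, 2],
-- [3, 2, …, 2, 3] respectively, and the corresponding ℛ are computed explicitly: [m]_q in the first two
-- cases, palindromic in the other two.

module Submission where

module Moments where

  open import Defs
  open import Data.Nat using (zero; suc)
  open import Data.Integer as ℤ using (ℤ; +_; -[1+_]; _+_; _*_; -_; _-_)
  open import Data.Integer.Properties
  open import Algebra.Properties.CommutativeSemigroup +-commutativeSemigroup using (interchange)
  open import Data.Integer.Tactic.RingSolver using (solve-∀)
  open import Data.List using ([]; _∷_; reverse; _++_; length; [_])
  open import Data.List.Properties using (length-reverse; unfold-reverse)
  open import Relation.Binary.PropositionalEquality hiding ([_])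

  -- at1 f = f(1) and deriv1 f = f′(1) = Σ i fᵢ.
  at1 : Poly → ℤ
  at1 [] = + 0
  at1 (x ∷ f) = x + at1 f

  deriv1 : Poly → ℤ
  deriv1 [] = + 0
  deriv1 (x ∷ f) = at1 f + deriv1 f

  at1-+P : ∀ f g → at1 (f +P g) ≡ at1 f + at1 g
  at1-+P [] g = sym (+-identityˡ (at1 g))
  at1-+P (x ∷ f) [] = sym (+-identityʳ _)
  at1-+P (x ∷ f) (y ∷ g) rewrite at1-+P f g = interchange x y (at1 f) (at1 g)

  deriv1-+P : ∀ f g → deriv1 (f +P g) ≡ deriv1 f + deriv1 g
  deriv1-+P [] g = sym (+-identityˡ (deriv1 g))
  deriv1-+P (x ∷ f) [] = sym (+-identityʳ _)
  deriv1-+P (x ∷ f) (y ∷ g) rewrite at1-+P f g | deriv1-+P f g =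
    interchange (at1 f) (at1 g) (deriv1 f) (deriv1 g)

  at1-negP : ∀ f → at1 (negP f) ≡ - at1 f
  at1-negP [] = refl
  at1-negP (x ∷ f) rewrite at1-negP f = sym (neg-distrib-+ x (at1 f))

  deriv1-negP : ∀ f → deriv1 (negP f) ≡ - deriv1 f
  deriv1-negP [] = refl
  deriv1-negP (x ∷ f) rewrite at1-negP f | deriv1-negP f = sym (neg-distrib-+ (at1 f) (deriv1 f))

  at1-scaleP : ∀ c f → at1 (scaleP c f) ≡ c * at1 f
  at1-scaleP c [] = sym (*-zeroʳ c)
  at1-scaleP c (x ∷ f) rewrite at1-scaleP c f = sym (*-distribˡ-+ c x (at1 f))

  deriv1-scaleP : ∀ c f → deriv1 (scaleP c f) ≡ c * deriv1 f
  deriv1-scaleP c [] = sym (*-zeroʳ c)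
  deriv1-scaleP c (x ∷ f) rewrite at1-scaleP c f | deriv1-scaleP c f =
    sym (*-distribˡ-+ c (at1 f) (deriv1 f))

  at1-*P : ∀ f g → at1 (f *P g) ≡ at1 f * at1 g
  at1-*P [] g = refl
  at1-*P (x ∷ f) g
    rewrite at1-+P (scaleP x g) (+ 0 ∷ (f *P g)) | at1-scaleP x g | at1-*P f g =
    by-ring x (at1 f) (at1 g)
    where
    by-ring : ∀ a b c → a * c + (+ 0 + b * c) ≡ (a + b) * c
    by-ring = solve-∀

  deriv1-*P : ∀ f g → deriv1 (f *P g) ≡ deriv1 f * at1 g + at1 f * deriv1 g
  deriv1-*P [] g = refl
  deriv1-*P (x ∷ f) g
    rewrite deriv1-+P (scaleP x g) (+ 0 ∷ (f *P g)) | deriv1-scaleP x g | at1-*P f g | deriv1-*P f g =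
    by-ring x (at1 f) (deriv1 f) (at1 g) (deriv1 g)
    where
    by-ring : ∀ a b c d e → a * e + (b * d + (c * d + b * e)) ≡ (b + c) * d + (a + b) * e
    by-ring = solve-∀

  at1-shiftP : ∀ k f → at1 (shiftP k f) ≡ at1 f
  at1-shiftP zero f = refl
  at1-shiftP (suc k) f = trans (+-identityˡ _) (at1-shiftP k f)

  deriv1-shiftP : ∀ k f → deriv1 (shiftP k f) ≡ deriv1 f + + k * at1 f
  deriv1-shiftP zero f = sym (trans (cong (_+_ (deriv1 f)) (*-zeroˡ (at1 f))) (+-identityʳ _))
  deriv1-shiftP (suc k) f rewrite at1-shiftP k f | deriv1-shiftP k f = by-ring (at1 f) (deriv1 f) (+ k)
    where
    by-ring : ∀ a b c → a + (b + c * a) ≡ b + (+ 1 + c) * a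
    by-ring = solve-∀

  at1-qint : ∀ n → at1 (qint n) ≡ + n
  at1-qint zero = refl
  at1-qint (suc n) rewrite at1-qint n = refl

  deriv1-qint : ∀ n → deriv1 (qint n) * + 2 ≡ + n * (+ n - + 1)
  deriv1-qint zero = refl
  deriv1-qint (suc n)
    rewrite *-distribʳ-+ (+ 2) (at1 (qint n)) (deriv1 (qint n)) | deriv1-qint n | at1-qint n = by-ring (+ n)
    where
    by-ring : ∀ a → a * + 2 + a * (a - + 1) ≡ (+ 1 + a) * ((+ 1 + a) - + 1)
    by-ring = solve-∀

  at1-strip : ∀ f → at1 (strip f) ≡ at1 f
  at1-strip [] = refl
  at1-strip (x ∷ f) with strip f | at1-strip f
  ... | y ∷ g | e = cong (_+_ x) e
  at1-strip (+ zero ∷ f)   | [] | e = cong (_+_ (+ 0)) e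
  at1-strip (+ suc n ∷ f)  | [] | e = cong (_+_ (+ suc n)) e
  at1-strip (-[1+ n ] ∷ f) | [] | e = cong (_+_ -[1+ n ]) e

  deriv1-strip : ∀ f → deriv1 (strip f) ≡ deriv1 f
  deriv1-strip [] = refl
  deriv1-strip (x ∷ f) with strip f | at1-strip f | deriv1-strip f
  ... | y ∷ g | e | d = cong₂ _+_ e d
  deriv1-strip (+ zero ∷ f)   | [] | e | d = cong₂ _+_ e d
  deriv1-strip (+ suc n ∷ f)  | [] | e | d = cong₂ _+_ e d
  deriv1-strip (-[1+ n ] ∷ f) | [] | e | d = cong₂ _+_ e d

  at1-++ : ∀ f g → at1 (f ++ g) ≡ at1 f + at1 g
  at1-++ [] g = sym (+-identityˡ _)
  at1-++ (x ∷ f) g rewrite at1-++ f g = sym (+-assoc x (at1 f) (at1 g))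

  deriv1-++ : ∀ f g → deriv1 (f ++ g) ≡ deriv1 f + + length f * at1 g + deriv1 g
  deriv1-++ [] g = by-ring (at1 g) (deriv1 g)
    where
    by-ring : ∀ e d → d ≡ + 0 + + 0 * e + d
    by-ring = solve-∀
  deriv1-++ (x ∷ f) g rewrite at1-++ f g | deriv1-++ f g =
    by-ring (at1 f) (at1 g) (deriv1 f) (deriv1 g) (+ length f)
    where
    by-ring : ∀ a b c d l → a + b + (c + l * b + d) ≡ a + c + (+ 1 + l) * b + d
    by-ring = solve-∀

  -- For a palindromic f of length l this gives 2 f′(1) = (l − 1) f(1).
  deriv1-reverse : ∀ f → deriv1 f + deriv1 (reverse f) + at1 f ≡ + length f * at1 f
  deriv1-reverse [] = refl
  deriv1-reverse (x ∷ f)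
    rewrite unfold-reverse x f | deriv1-++ (reverse f) [ x ] | length-reverse f =
    step (at1 f) (deriv1 f) (deriv1 (reverse f)) x (+ length f) (deriv1-reverse f)
    where
    step : ∀ e d d′ x l → d + d′ + e ≡ l * e →
           e + d + (d′ + l * (x + + 0) + + 0) + (x + e) ≡ (+ 1 + l) * (x + e)
    step e d d′ x l h = begin
      e + d + (d′ + l * (x + + 0) + + 0) + (x + e) ≡⟨ regroup e d d′ x l ⟩
      (d + d′ + e) + l * x + x + e                  ≡⟨ cong (λ z → z + l * x + x + e) h ⟩
      l * e + l * x + x + e                         ≡⟨ factor e x l ⟩
      (+ 1 + l) * (x + e)                           ∎
      where
      open ≡-Reasoning
      regroup : ∀ e d d′ x l → e + d + (d′ + l * (x + + 0) + + 0) + (x + e) ≡ (d + d′ + e) + l * x + x + e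
      regroup = solve-∀
      factor : ∀ e x l → l * e + l * x + x + e ≡ (+ 1 + l) * (x + e)
      factor = solve-∀

module ContinuantsAtOne where

  open import Defs
  open Moments
  open import Data.Nat as ℕ using (ℕ; suc)
  open import Data.Integer as ℤ using (ℤ; +_; _+_; _*_; -_; _-_)
  open import Data.Integer.Properties
  open import Data.Integer.Tactic.RingSolver using (solve-∀)
  open import Data.List using (List; []; _∷_; reverse; length)
  open import Data.List.Relation.Unary.All using (All; []; _∷_)
  open import Data.Product using (Σ; _,_; proj₁; proj₂)
  open import Relation.Binary.PropositionalEquality

  -- For a word c₁ ⋯ c_l with M(c) = [[c, −1], [1, 0]] (the specialisation q = 1 of M⁻_q(c)):
  -- (r, s) = M(c₁)⋯M(c_l)(1, 0), (x, y) = M(c₁)⋯M(c_l)(0, −1), D = Σᵢ (cᵢ − 1),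
  -- and E, t, z are the values of D, s, y for the word c₂ ⋯ c_l.
  record Continuants : Set where
    constructor mkContinuants
    field r s x y D E t z : ℤ

  continuants : List ℕ → Continuants
  continuants [] = mkContinuants (+ 1) (+ 0) (+ 0) (- + 1) (+ 0) (+ 0) (- + 1) (+ 0)
  continuants (c ∷ w) = mkContinuants (+ c * r - s) r (+ c * x - y) x ((+ c - + 1) + D) D s y
    where open Continuants (continuants w)

  record RS-at1 (R S : Poly) (k : Continuants) : Set where
    open Continuants k
    field
      R-at1     : at1 R ≡ r
      S-at1     : at1 S ≡ s
      R-deriv1  : deriv1 R * + 2 ≡ D * r + s - x
      S-deriv1  : deriv1 S * + 2 ≡ E * s + t - y
      r≡        : r ≡ s * (+ 1 + D - E) - t
      det       : x * s - r * y ≡ + 1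
      det-tail  : y * t - s * z ≡ + 1

  rs-at1 : ∀ w → All (1 ℕ.≤_) w → RS-at1 (proj₁ (RSvec w)) (proj₂ (RSvec w)) (continuants w)
  rs-at1 [] [] = record
    { R-at1 = refl ; S-at1 = refl ; R-deriv1 = refl ; S-deriv1 = refl
    ; r≡ = refl ; det = refl ; det-tail = refl }
  rs-at1 (suc k ∷ w) (_ ∷ w≥1) with RSvec w | continuants w | rs-at1 w w≥1
  ... | R , S | mkContinuants r s x y D E t z | I = record
    { R-at1 = R′-at1 ; S-at1 = R-at1 ; R-deriv1 = R′-deriv1 ; S-deriv1 = R-deriv1
    ; r≡ = r′≡ (+ suc k) r s D ; det = trans (det′ (+ suc k) x y r s) det ; det-tail = det }
    where
    open RS-at1 I
    open ≡-Reasoning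
    c = + suc k
    R′ = (qint (suc k) *P R) +P negP (shiftP k S)

    R′-at1 : at1 R′ ≡ c * r - s
    R′-at1 rewrite at1-+P (qint (suc k) *P R) (negP (shiftP k S)) | at1-*P (qint (suc k)) R
                 | at1-negP (shiftP k S) | at1-shiftP k S | at1-qint (suc k) | R-at1 | S-at1 = refl

    R′-deriv1 : deriv1 R′ * + 2 ≡ ((c - + 1) + D) * (c * r - s) + r - (c * x - y)
    R′-deriv1 = begin
      deriv1 R′ * + 2
        ≡⟨ cong (_* + 2) (trans (deriv1-+P (qint (suc k) *P R) (negP (shiftP k S)))
             (cong₂ _+_ (deriv1-*P (qint (suc k)) R) (trans (deriv1-negP (shiftP k S)) (cong -_ (deriv1-shiftP k S))))) ⟩
      (deriv1 (qint (suc k)) * at1 R + at1 (qint (suc k)) * deriv1 R + - (deriv1 S + + k * at1 S)) * + 2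
        ≡⟨ double (deriv1 (qint (suc k))) (at1 R) (at1 (qint (suc k))) (deriv1 R) (deriv1 S) (+ k) (at1 S) ⟩
      (deriv1 (qint (suc k)) * + 2) * at1 R + at1 (qint (suc k)) * (deriv1 R * + 2) - (deriv1 S * + 2 + + 2 * + k * at1 S)
        ≡⟨ cong₂ (λ a b → a * at1 R + at1 (qint (suc k)) * b - (deriv1 S * + 2 + + 2 * + k * at1 S))
                 (deriv1-qint (suc k)) R-deriv1 ⟩
      c * (c - + 1) * at1 R + at1 (qint (suc k)) * (D * r + s - x) - (deriv1 S * + 2 + + 2 * + k * at1 S)
        ≡⟨ cong₂ (λ a b → c * (c - + 1) * at1 R + a * (D * r + s - x) - (b + + 2 * + k * at1 S))
                 (at1-qint (suc k)) S-deriv1 ⟩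
      c * (c - + 1) * at1 R + c * (D * r + s - x) - (E * s + t - y + + 2 * + k * at1 S)
        ≡⟨ cong₂ (λ a b → c * (c - + 1) * a + c * (D * r + s - x) - (E * s + t - y + + 2 * + k * b))
                 R-at1 S-at1 ⟩
      c * (c - + 1) * r + c * (D * r + s - x) - (E * s + t - y + + 2 * + k * s)
        ≡⟨ close (+ k) r s D E t x y r≡ ⟩
      ((c - + 1) + D) * (c * r - s) + r - (c * x - y) ∎
      where
      double : ∀ mq er eq mr ms k es → (mq * er + eq * mr + - (ms + k * es)) * + 2 ≡
               (mq * + 2) * er + eq * (mr * + 2) - (ms * + 2 + + 2 * k * es)
      double = solve-∀
      by-ring : ∀ k s D E t x y →
        (+ 1 + k) * ((+ 1 + k) - + 1) * (s * (+ 1 + D - E) - t)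
          + (+ 1 + k) * (D * (s * (+ 1 + D - E) - t) + s - x) - (E * s + t - y + + 2 * k * s)
        ≡ (((+ 1 + k) - + 1) + D) * ((+ 1 + k) * (s * (+ 1 + D - E) - t) - s)
          + (s * (+ 1 + D - E) - t) - ((+ 1 + k) * x - y)
      by-ring = solve-∀
      close : ∀ k r s D E t x y → r ≡ s * (+ 1 + D - E) - t →
        (+ 1 + k) * ((+ 1 + k) - + 1) * r + (+ 1 + k) * (D * r + s - x) - (E * s + t - y + + 2 * k * s)
        ≡ (((+ 1 + k) - + 1) + D) * ((+ 1 + k) * r - s) + r - ((+ 1 + k) * x - y)
      close k _ s D E t x y refl = by-ring k s D E t x y

    r′≡ : ∀ c r s D → c * r - s ≡ r * (+ 1 + (c - + 1 + D) - D) - s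
    r′≡ = solve-∀
    det′ : ∀ c x y r s → (c * x - y) * r - (c * r - s) * x ≡ x * s - r * y
    det′ = solve-∀

  -- Compare 2 S′(1) = (deg S) S(1) with S-deriv1.
  palindromic⇒t-y≡[s] : ∀ {R S k} → RS-at1 R S k → Palindromic S →
                        Σ ℤ λ q → Continuants.t k - Continuants.y k ≡ q * Continuants.s k
  palindromic⇒t-y≡[s] {R} {S} {mkContinuants r s x y D E t z} I pal = l - E - + 1 , t-y≡
    where
    open RS-at1 I
    open ≡-Reasoning
    L = strip S
    l = + length L

    2S′≡ : deriv1 S + deriv1 S + s ≡ l * s
    2S′≡ = begin
      deriv1 S + deriv1 S + s          ≡⟨ cong (λ u → u + u + s) (sym (deriv1-strip S)) ⟩
      deriv1 L + deriv1 L + s          ≡⟨ cong (λ u → deriv1 L + deriv1 u + s) (sym pal) ⟩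
      deriv1 L + deriv1 (reverse L) + s ≡⟨ cong (_+_ (deriv1 L + deriv1 (reverse L))) (sym L-at1) ⟩
      deriv1 L + deriv1 (reverse L) + at1 L ≡⟨ deriv1-reverse L ⟩
      l * at1 L                        ≡⟨ cong (l *_) L-at1 ⟩
      l * s                            ∎
      where
      L-at1 : at1 L ≡ s
      L-at1 = trans (at1-strip S) S-at1

    t-y≡ : t - y ≡ (l - E - + 1) * s
    t-y≡ = begin
      t - y                             ≡⟨ by-ring₁ E s t y ⟩
      (E * s + t - y) - E * s           ≡⟨ cong (_- E * s) (sym S-deriv1) ⟩
      deriv1 S * + 2 - E * s            ≡⟨ by-ring₂ (deriv1 S) s E ⟩
      (deriv1 S + deriv1 S + s) - s - E * s ≡⟨ cong (λ u → u - s - E * s) 2S′≡ ⟩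
      l * s - s - E * s                 ≡⟨ by-ring₃ l s E ⟩
      (l - E - + 1) * s                 ∎
      where
      by-ring₁ : ∀ E s t y → t - y ≡ (E * s + t - y) - E * s
      by-ring₁ = solve-∀
      by-ring₂ : ∀ m s E → m * + 2 - E * s ≡ (m + m + s) - s - E * s
      by-ring₂ = solve-∀
      by-ring₃ : ∀ l s E → l * s - s - E * s ≡ (l - E - + 1) * s
      by-ring₃ = solve-∀

module NegativeContinuedFraction where

  open import Defs
  open import Data.Nat as ℕ using (ℕ; zero; suc; _+_; _*_; _∸_; _≡ᵇ_; _≤_; _<_; s≤s; z≤n)
  open import Data.Nat.Properties
  open import Data.Nat.DivMod using (_/_; _%_; m≡m%n+[m/n]*n; m%n<n)
  open import Data.Nat.Coprimality using (Coprime)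
  open import Data.Nat.Divisibility using (_∣_; divides; ∣-refl; ∣-trans; n∣m*n; ∣m+n∣m⇒∣n)
  open import Data.Integer as ℤ using (ℤ; +_; _-_)
  import Data.Integer.Properties as ℤP
  open import Data.Integer.Tactic.RingSolver using (solve-∀)
  open import Data.List using (List; []; _∷_)
  open import Data.List.Relation.Unary.All using (All; []; _∷_)
  open import Data.Bool using (true; false; T)
  open import Data.Product using (_×_; _,_; proj₁; proj₂)
  open import Data.Empty using (⊥-elim)
  open import Relation.Nullary using (Dec; yes; no)
  open import Relation.Binary.PropositionalEquality
  open ContinuantsAtOne

  -- c = ⌈r / s⌉ for s = 1 + s′.
  ceil-bounds : ∀ r s′ → r ≤ (r + s′) / suc s′ * suc s′ × (r + s′) / suc s′ * suc s′ < r + suc s′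
  ceil-bounds r s′ = lower , upper
    where
    open ≤-Reasoning
    s = suc s′
    c = (r + s′) / s
    split : r + s′ ≡ (r + s′) % s + c * s
    split = m≡m%n+[m/n]*n (r + s′) s
    lower : r ≤ c * s
    lower = +-cancelʳ-≤ s′ r (c * s) (begin
      r + s′               ≡⟨ split ⟩
      (r + s′) % s + c * s ≤⟨ +-monoˡ-≤ (c * s) (≤-pred (m%n<n (r + s′) s)) ⟩
      s′ + c * s           ≡⟨ +-comm s′ (c * s) ⟩
      c * s + s′           ∎)
    upper : c * s < r + s
    upper = begin-strict
      c * s                ≤⟨ m≤n+m (c * s) ((r + s′) % s) ⟩
      (r + s′) % s + c * s ≡⟨ split ⟨
      r + s′               <⟨ +-monoʳ-< r (n<1+n s′) ⟩
      r + s                ∎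

  ceil-remainder< : ∀ r s′ → (r + s′) / suc s′ * suc s′ ∸ r < suc s′
  ceil-remainder< r s′ = +-cancelʳ-< r _ (suc s′)
    (subst₂ _<_ (sym (m∸n+n≡m (proj₁ (ceil-bounds r s′)))) (+-comm r (suc s′)) (proj₂ (ceil-bounds r s′)))

  ncf-stop : ∀ f r s′ {c} → (r + s′) / suc s′ ≡ c → c * suc s′ ≡ r → ncf (suc f) r (suc s′) ≡ c ∷ []
  ncf-stop f r s′ refl e with (r + s′) / suc s′ * suc s′ ≡ᵇ r | ≡⇒≡ᵇ _ r e
  ... | true | _ = refl

  ncf-step : ∀ f r s′ {c} → (r + s′) / suc s′ ≡ c → c * suc s′ ≢ r →
             ncf (suc f) r (suc s′) ≡ c ∷ ncf f (suc s′) (c * suc s′ ∸ r)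
  ncf-step f r s′ refl ne with (r + s′) / suc s′ * suc s′ ≡ᵇ r in eq
  ... | false = refl
  ... | true = ⊥-elim (ne (≡ᵇ⇒≡ _ r (subst T (sym eq) _)))

  record Expands (w : List ℕ) (r s : ℕ) : Set where
    field
      positive : All (1 ≤_) w
      r≡ : Continuants.r (continuants w) ≡ + r
      s≡ : Continuants.s (continuants w) ≡ + s

  ceil-positive : ∀ {c S r} → 0 < r → r ≤ c * S → 1 ≤ c
  ceil-positive {zero} 0<r r≤0 = ⊥-elim (<-irrefl refl (<-≤-trans 0<r r≤0))
  ceil-positive {suc c} _ _ = s≤s z≤n

  ncf-expands : ∀ f r s → 1 ≤ s → s < r → s ≤ f → Coprime r s → Expands (ncf f r s) r s
  ncf-expands zero r s 1≤s _ s≤0 _ = ⊥-elim (<-irrefl refl (<-≤-trans 1≤s s≤0))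
  ncf-expands (suc f) r (suc s′) _ s<r s≤f coprime = expand (c * S ≟ r)
    where
    c = (r + s′) / suc s′
    S = suc s′
    r≤cS = proj₁ (ceil-bounds r s′)
    c≥1 : 1 ≤ c
    c≥1 = ceil-positive (<-≤-trans (s≤s z≤n) s<r) r≤cS

    expand : Dec (c * S ≡ r) → Expands (ncf (suc f) r S) r S
    expand (yes cS≡r) = subst (λ w → Expands w r S) (sym (ncf-stop f r s′ refl cS≡r)) (record
      { positive = c≥1 ∷ []
      ; r≡ = trans (ℤP.+-identityʳ _)
                   (trans (sym (ℤP.pos-* c 1)) (cong +_ (trans (cong (c *_) (sym S≡1)) cS≡r)))
      ; s≡ = cong +_ (sym S≡1) })
      where
      S≡1 : S ≡ 1
      S≡1 = coprime (divides c (sym cS≡r) , ∣-refl)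
    expand (no cS≢r) = subst (λ w → Expands w r S) (sym (ncf-step f r s′ refl cS≢r)) (record
      { positive = c≥1 ∷ positive
      ; r≡ = begin
          + c ℤ.* Continuants.r k - Continuants.s k ≡⟨ cong₂ (λ u v → + c ℤ.* u - v) r≡ s≡ ⟩
          + c ℤ.* + S - + t                         ≡⟨ cong (_- + t) (sym (ℤP.pos-* c S)) ⟩
          + (c * S) - + t                           ≡⟨ cong (λ u → + u - + t) (sym (m∸n+n≡m r≤cS)) ⟩
          + (t + r) - + t                           ≡⟨ cong (_- + t) (ℤP.pos-+ t r) ⟩
          + t ℤ.+ + r - + t                         ≡⟨ cancel (+ t) (+ r) ⟩
          + r                                       ∎
      ; s≡ = r≡ })
      where
      open ≡-Reasoning
      t = c * S ∸ r
      k = continuants (ncf f S t)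
      r<cS : r < c * S
      r<cS = ≤∧≢⇒< r≤cS (≢-sym cS≢r)
      t<S : t < S
      t<S = ceil-remainder< r s′
      coprime′ : Coprime S t
      coprime′ {d} (d∣S , d∣t) =
        coprime (∣m+n∣m⇒∣n (subst (d ∣_) (sym (m∸n+n≡m r≤cS)) (∣-trans d∣S (n∣m*n c))) d∣t , d∣S)
      cancel : ∀ a b → a ℤ.+ b - a ≡ b
      cancel = solve-∀
      open Expands (ncf-expands f S t (m<n⇒0<n∸m r<cS) t<S (≤-trans (≤-pred t<S) (≤-pred s≤f)) coprime′)

module Reduction where

  open import Defs
  open import Data.Nat as ℕ using (ℕ; zero; suc; _∸_; _<ᵇ_; _≤_; _<_; s≤s; z≤n)
  open import Data.Nat.Properties as ℕP
  open import Data.Integer as ℤ using (ℤ; +_; -[1+_]; ∣_∣)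
  import Data.Integer.Properties as ℤP
  open import Data.Bool using (true; false; T)
  open import Data.Empty using (⊥-elim)
  open import Relation.Binary.PropositionalEquality

  record Reduces (fuel : ℕ) (a : ℤ) (m : ℕ) : Set where
    field
      r    : ℕ
      m<r  : m < r
      k    : ℕ
      r≡   : + r ≡ a ℤ.+ + (k ℕ.* m)
      S≡   : Sfuel fuel a m ≡ S>1 r m

  private
    +[1+f]m : ∀ a m f → a ℤ.+ + (suc f ℕ.* m) ≡ (a ℤ.+ + m) ℤ.+ + (f ℕ.* m)
    +[1+f]m a m f = trans (cong (ℤ._+_ a) (ℤP.pos-+ m (f ℕ.* m))) (sym (ℤP.+-assoc a (+ m) (+ (f ℕ.* m))))

    Sfuel-stop : ∀ f r m → (m <ᵇ r) ≡ true → Sfuel (suc f) (+ r) m ≡ S>1 r m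
    Sfuel-stop f r m e rewrite e = refl

    Sfuel-continue : ∀ f r m → (m <ᵇ r) ≡ false → Sfuel (suc f) (+ r) m ≡ Sfuel f (+ r ℤ.+ + m) m
    Sfuel-continue f r m e rewrite e = refl

  Sfuel-reduces : ∀ m f a → + m ℤ.< a ℤ.+ + (f ℕ.* m) → Reduces (suc f) a m
  Sfuel-reduces m f (+ r) m<a+fm with m <ᵇ r in eq
  ... | true = record { r = r ; m<r = <ᵇ⇒< m r (subst T (sym eq) _) ; k = 0
                      ; r≡ = sym (ℤP.+-identityʳ (+ r)) ; S≡ = Sfuel-stop f r m eq }
  Sfuel-reduces m zero (+ r) m<a+fm | false =
    ⊥-elim (subst T eq (<⇒<ᵇ (ℤP.drop‿+<+ (subst (+ m ℤ.<_) (ℤP.+-identityʳ (+ r)) m<a+fm))))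
  Sfuel-reduces m (suc f) (+ r) m<a+fm | false =
    record { r = r′ ; m<r = m<r ; k = suc k ; r≡ = trans r≡ (sym (+[1+f]m (+ r) m k))
           ; S≡ = trans (Sfuel-continue (suc f) r m eq) S≡ }
    where
    R = Sfuel-reduces m f (+ r ℤ.+ + m) (subst (+ m ℤ.<_) (+[1+f]m (+ r) m f) m<a+fm)
    open Reduces R using (m<r; k; r≡; S≡) renaming (r to r′)
  Sfuel-reduces m zero -[1+ r ] m<a+fm = ⊥-elim (ℤP.+≮- (subst (+ m ℤ.<_) (ℤP.+-identityʳ -[1+ r ]) m<a+fm))
  Sfuel-reduces m (suc f) -[1+ r ] m<a+fm =
    record { r = r′ ; m<r = m<r ; k = suc k ; r≡ = trans r≡ (sym (+[1+f]m -[1+ r ] m k)) ; S≡ = S≡ }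
    where
    R = Sfuel-reduces m f (-[1+ r ] ℤ.+ + m) (subst (+ m ℤ.<_) (+[1+f]m -[1+ r ] m f) m<a+fm)
    open Reduces R using (m<r; k; r≡; S≡) renaming (r to r′)

  enough-fuel : ∀ m a → 2 ≤ m → a ≢ + 0 → + m ℤ.< a ℤ.+ + ((∣ a ∣ ℕ.+ 1) ℕ.* m)
  enough-fuel m (+ zero) _ a≢0 = ⊥-elim (a≢0 refl)
  enough-fuel m@(suc _) (+ suc r) _ _ =
    ℤ.+<+ (s≤s (≤-trans (m≤n*m m (suc r ℕ.+ 1)) (m≤n+m _ r)))
  enough-fuel (suc zero) -[1+ r ] (s≤s ()) _
  enough-fuel m@(suc (suc _)) -[1+ r ] _ _ =
    subst (+ m ℤ.<_) (sym (ℤP.⊖-≥ (≤-trans (m≤n+m (suc r) m) (<⇒≤ m+1+r<X)))) (ℤ.+<+ m<X∸[1+r])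
    where
    X = (suc r ℕ.+ 1) ℕ.* m
    m+1+r<X : m ℕ.+ suc r < X
    m+1+r<X = subst (m ℕ.+ suc r <_) (cong (ℕ._* m) (+-comm 1 (suc r)))
                (+-monoʳ-< m (m<m*n (suc r) m (s≤s (s≤s z≤n))))
    m<X∸[1+r] : m < X ∸ suc r
    m<X∸[1+r] = subst (_< X ∸ suc r) (m+n∸n≡m m (suc r)) (∸-monoˡ-< m+1+r<X (m≤n+m (suc r) m))

  𝒮-reduces : ∀ m a → 2 ≤ m → a ≢ + 0 → Reduces (∣ a ∣ ℕ.+ 2) a m
  𝒮-reduces m a 2≤m a≢0 =
    subst (λ f → Reduces f a m) (sym (+-suc ∣ a ∣ 1)) (Sfuel-reduces m (∣ a ∣ ℕ.+ 1) a (enough-fuel m a 2≤m a≢0))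

module Necessity where

  open import Defs
  open ContinuantsAtOne
  open NegativeContinuedFraction
  open Reduction
  open import Data.Nat as ℕ using (ℕ; zero; suc; _≤_; s≤s; z≤n)
  open import Data.Nat.Properties as ℕP using (≤-trans; ≤-refl)
  import Data.Nat.Divisibility as ℕ∣
  open import Data.Nat.Coprimality using (Coprime)
  open import Data.Integer as ℤ using (ℤ; +_; ∣_∣; _+_; _*_; _-_)
  import Data.Integer.Properties as ℤP
  open import Data.Integer.Divisibility.Signed using (_∣_; divides; ∣ᵤ⇒∣; ∣⇒∣ᵤ; ∣m∣n⇒∣m-n)
  open import Data.Integer.Tactic.RingSolver using (solve-∀)
  open import Data.Product using (_,_; proj₁; proj₂)
  open import Relation.Binary.PropositionalEquality

  -- a ≡ r − k s ≡ −t and y ≡ t (mod s), so a² ≡ t² ≡ y t − s z = 1.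
  a²≡1-mod : ∀ s D E t y z q a k → a + k * s ≡ s * (+ 1 + D - E) - t → t - y ≡ q * s →
             y * t - s * z ≡ + 1 → s ∣ a * a - + 1
  a²≡1-mod s D E t y z q a k a≡ t-y≡ det =
    subst (λ u → s ∣ a * a - u) det (core a y (trans (rearrangeₐ a (k * s)) (cong (_- k * s) a≡))
                                               (trans (rearrangeᵧ t y) (cong (t -_) t-y≡)))
    where
    core : ∀ a y → a ≡ s * (+ 1 + D - E) - t - k * s → y ≡ t - q * s → s ∣ a * a - (y * t - s * z)
    core _ _ refl refl = divides (((+ 1 + D - E) - k) * ((s * (+ 1 + D - E) - t - k * s) - t) + t * q + z)
                                  (by-ring s D E t z q k)
      where
      by-ring : ∀ s D E t z q k →
        (s * (+ 1 + D - E) - t - k * s) * (s * (+ 1 + D - E) - t - k * s) - ((t - q * s) * t - s * z)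
        ≡ (((+ 1 + D - E) - k) * ((s * (+ 1 + D - E) - t - k * s) - t) + t * q + z) * s
      by-ring = solve-∀
    rearrangeₐ : ∀ a b → a ≡ (a + b) - b
    rearrangeₐ = solve-∀
    rearrangeᵧ : ∀ t y → y ≡ t - (t - y)
    rearrangeᵧ = solve-∀

  coprime-shift : ∀ a {m r} k → Coprime ∣ a ∣ m → + r ≡ a + + (k ℕ.* m) → Coprime r m
  coprime-shift a {m} {r} k coprime r≡ {d} (d∣r , d∣m) = coprime (∣⇒∣ᵤ {+ d} {a} d∣a , d∣m)
    where
    a≡ : + r - + (k ℕ.* m) ≡ a
    a≡ = trans (cong (_- + (k ℕ.* m)) r≡) (cancel a (+ (k ℕ.* m)))
      where
      cancel : ∀ a b → a + b - b ≡ a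
      cancel = solve-∀
    d∣a : + d ∣ a
    d∣a = subst (+ d ∣_) a≡ (∣m∣n⇒∣m-n (∣ᵤ⇒∣ {+ d} {+ r} d∣r) (∣ᵤ⇒∣ {+ d} {+ (k ℕ.* m)} (ℕ∣.∣-trans d∣m (ℕ∣.n∣m*n k))))

  coprime⇒≢0 : ∀ {a m} → 2 ≤ m → Coprime ∣ a ∣ m → a ≢ + 0
  coprime⇒≢0 {m = suc zero} (s≤s ()) _
  coprime⇒≢0 {m = suc (suc _)} _ coprime refl with coprime (ℕ∣._∣0 _ , ℕ∣.∣-refl)
  ... | ()

  palindromic⇒m∣a²-1 : ∀ m a → 2 ≤ m → Coprime ∣ a ∣ m → Palindromic (𝒮 a m) → + m ∣ a * a - + 1
  palindromic⇒m∣a²-1 m a 2≤m coprime pal =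
    subst (λ u → u ∣ a * a - + 1) (Expands.s≡ expansion) (a²≡1-mod s D E t y z q a (+ k) a+ks≡r t-y≡ det-tail)
    where
    open Reduces (𝒮-reduces m a 2≤m (coprime⇒≢0 2≤m coprime)) using (k; m<r; S≡) renaming (r to r′; r≡ to r′≡)
    w = ncf m r′ m
    expansion = ncf-expands m r′ m (≤-trans (s≤s z≤n) 2≤m) m<r ≤-refl (coprime-shift a k coprime r′≡)
    I = rs-at1 w (Expands.positive expansion)
    open Continuants (continuants w)
    open RS-at1 I using (det-tail)
    q = proj₁ (palindromic⇒t-y≡[s] I (subst Palindromic S≡ pal))
    t-y≡ = proj₂ (palindromic⇒t-y≡[s] I (subst Palindromic S≡ pal))
    a+ks≡r : a + + k * s ≡ s * (+ 1 + D - E) - t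
    a+ks≡r = begin
      a + + k * s       ≡⟨ cong (λ u → a + + k * u) (Expands.s≡ expansion) ⟩
      a + + k * + m     ≡⟨ cong (_+_ a) (sym (ℤP.pos-* k m)) ⟩
      a + + (k ℕ.* m)   ≡⟨ sym r′≡ ⟩
      + r′              ≡⟨ sym (Expands.r≡ expansion) ⟩
      r                 ≡⟨ RS-at1.r≡ I ⟩
      s * (+ 1 + D - E) - t ∎
      where open ≡-Reasoning

module SquareRootsOfOne where

  open import Data.Nat as ℕ using (ℕ; zero; suc; _^_; _%_; s≤s)
  open import Data.Nat.Properties as ℕP using ()
  import Data.Nat.Divisibility as ℕ∣
  open import Data.Nat.Primality using (Prime; euclidsLemma; prime[2]; prime⇒nonZero; prime⇒nonTrivial)
  open import Data.Nat.Coprimality using (Coprime)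
  open import Data.Integer as ℤ using (ℤ; +_; ∣_∣; _+_; _*_; _-_)
  import Data.Integer.Properties as ℤP
  open import Data.Integer.DivMod using (_%ℕ_; _/ℕ_; n%ℕd<d; a≡a%ℕn+[a/ℕn]*n)
  open import Data.Integer.Divisibility.Signed using (_∣_; divides; ∣ᵤ⇒∣; ∣⇒∣ᵤ; ∣m∣n⇒∣m-n)
  open import Data.Integer.Tactic.RingSolver using (solve-∀)
  open import Data.Product using (Σ; _,_)
  open import Data.Sum using (_⊎_; inj₁; inj₂; [_,_]′)
  open import Data.Empty using (⊥-elim)
  open import Relation.Nullary using (¬_; yes; no)
  open import Relation.Binary.PropositionalEquality

  p^n∣uv⇒p^n∣u : ∀ {p} → Prime p → ∀ n u v → ¬ (p ℕ∣.∣ v) → (p ^ n) ℕ∣.∣ u ℕ.* v → (p ^ n) ℕ∣.∣ u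
  p^n∣uv⇒p^n∣u p-prime zero u v _ _ = ℕ∣.1∣ u
  p^n∣uv⇒p^n∣u {p} p-prime (suc n) u v p∤v p^n∣uv
    with euclidsLemma u v p-prime (ℕ∣.∣-trans (ℕ∣.m∣m*n (p ^ n)) p^n∣uv)
  ... | inj₂ p∣v = ⊥-elim (p∤v p∣v)
  ... | inj₁ (ℕ∣.divides u′ refl) =
    subst (p ℕ.* (p ^ n) ℕ∣.∣_) (ℕP.*-comm p u′) (ℕ∣.*-monoʳ-∣ p (p^n∣uv⇒p^n∣u p-prime n u′ v p∤v p^n∣u′v))
    where
    instance _ = prime⇒nonZero p-prime
    p^n∣u′v : (p ^ n) ℕ∣.∣ u′ ℕ.* v
    p^n∣u′v = ℕ∣.*-cancelˡ-∣ p (subst (p ℕ.* (p ^ n) ℕ∣.∣_)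
                (trans (cong (ℕ._* v) (ℕP.*-comm u′ p)) (ℕP.*-assoc p u′ v)) p^n∣uv)

  p^n∣uv⇒p^n∣u⊎p^n∣v : ∀ {p} → Prime p → ∀ n u v → ¬ (+ p ∣ v - u) →
                       + (p ^ n) ∣ u * v → (+ (p ^ n) ∣ u) ⊎ (+ (p ^ n) ∣ v)
  p^n∣uv⇒p^n∣u⊎p^n∣v {p} p-prime n u v p∤v-u p^n∣uv with p ℕ∣.∣? ∣ v ∣ | p ℕ∣.∣? ∣ u ∣
  ... | no p∤v | _ = inj₁ (∣ᵤ⇒∣ (p^n∣uv⇒p^n∣u p-prime n ∣ u ∣ ∣ v ∣ p∤v
                        (subst ((p ^ n) ℕ∣.∣_) (ℤP.abs-* u v) (∣⇒∣ᵤ p^n∣uv))))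
  ... | yes _ | no p∤u = inj₂ (∣ᵤ⇒∣ (p^n∣uv⇒p^n∣u p-prime n ∣ v ∣ ∣ u ∣ p∤u
                        (subst ((p ^ n) ℕ∣.∣_) (trans (ℤP.abs-* u v) (ℕP.*-comm ∣ u ∣ ∣ v ∣)) (∣⇒∣ᵤ p^n∣uv))))
  ... | yes p∣v | yes p∣u = ⊥-elim (p∤v-u (∣m∣n⇒∣m-n (∣ᵤ⇒∣ {+ p} {v} p∣v) (∣ᵤ⇒∣ {+ p} {u} p∣u)))

  odd-prime∤2 : ∀ {p} → Prime p → p % 2 ≡ 1 → ¬ (+ p ∣ + 2)
  odd-prime∤2 {p} p-prime p-odd p∣2 with ℕ∣.∣⇒≤ (∣⇒∣ᵤ p∣2) | ℕ.nonTrivial⇒n>1 p {{prime⇒nonTrivial p-prime}}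
  odd-prime∤2 {suc (suc zero)} p-prime () p∣2 | _ | _
  odd-prime∤2 {suc (suc (suc _))} p-prime p-odd p∣2 | s≤s (s≤s ()) | _

  p^n∣a²-1⇒a≡±1 : ∀ {p} → Prime p → p % 2 ≡ 1 → ∀ n a → + (p ^ n) ∣ a * a - + 1 →
                  (+ (p ^ n) ∣ a - + 1) ⊎ (+ (p ^ n) ∣ a + + 1)
  p^n∣a²-1⇒a≡±1 p-prime p-odd n a p^n∣a²-1 =
    p^n∣uv⇒p^n∣u⊎p^n∣v p-prime n (a - + 1) (a + + 1)
      (λ p∣2 → odd-prime∤2 p-prime p-odd (subst (_ ∣_) (difference a) p∣2))
      (subst (_ ∣_) (factor a) p^n∣a²-1)
    where
    difference : ∀ a → (a + + 1) - (a - + 1) ≡ + 2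
    difference = solve-∀
    factor : ∀ a → a * a - + 1 ≡ (a - + 1) * (a + + 1)
    factor = solve-∀

  even⊎odd : ∀ x → (Σ ℤ λ f → x ≡ f * + 2) ⊎ (Σ ℤ λ f → x ≡ + 1 + f * + 2)
  even⊎odd x with x %ℕ 2 | n%ℕd<d x 2 | a≡a%ℕn+[a/ℕn]*n x 2
  ... | 0 | _ | x≡ = inj₁ (x /ℕ 2 , trans x≡ (ℤP.+-identityˡ _))
  ... | 1 | _ | x≡ = inj₂ (x /ℕ 2 , x≡)
  ... | suc (suc _) | s≤s (s≤s ()) | _

  h∣x⇒2h∣x⊎2h∣x-h : ∀ h x → + h ∣ x → (+ (2 ℕ.* h) ∣ x) ⊎ (+ (2 ℕ.* h) ∣ x - + h)
  h∣x⇒2h∣x⊎2h∣x-h h x (divides q x≡) with even⊎odd q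
  ... | inj₁ (f , refl) =
    inj₁ (divides f (trans x≡ (trans (by-ring₁ f (+ h)) (cong (f *_) (sym (ℤP.pos-* 2 h))))))
    where
    by-ring₁ : ∀ f h → f * + 2 * h ≡ f * (+ 2 * h)
    by-ring₁ = solve-∀
  ... | inj₂ (f , refl) =
    inj₂ (divides f (trans (cong (_- + h) x≡) (trans (by-ring₂ f (+ h)) (cong (f *_) (sym (ℤP.pos-* 2 h))))))
    where
    by-ring₂ : ∀ f h → (+ 1 + f * + 2) * h - h ≡ f * (+ 2 * h)
    by-ring₂ = solve-∀

  coprime-2^[1+n]⇒odd : ∀ n a → Coprime ∣ a ∣ (2 ^ suc n) → Σ ℤ λ e → a ≡ + 1 + e * + 2
  coprime-2^[1+n]⇒odd n a coprime with even⊎odd a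
  ... | inj₂ odd = odd
  ... | inj₁ (f , a≡) with coprime (∣⇒∣ᵤ {+ 2} {a} (divides f a≡) , ℕ∣.divides (2 ^ n) (ℕP.*-comm 2 (2 ^ n)))
  ...   | ()

  -- Writing a = 1 + 2e, a² − 1 = 4 e (e + 1) and e, e + 1 are coprime.
  2^[2+k]∣a²-1⇒a≡±1 : ∀ k a e → a ≡ + 1 + e * + 2 → + (2 ^ (2 ℕ.+ k)) ∣ a * a - + 1 →
                      (+ (2 ^ suc k) ∣ a - + 1) ⊎ (+ (2 ^ suc k) ∣ a + + 1)
  2^[2+k]∣a²-1⇒a≡±1 k a e refl (divides Q a²-1≡) =
    [ (λ { (divides c e≡)   → inj₁ (divides c (a-1≡ c e e≡)) })
    , (λ { (divides c e+1≡) → inj₂ (divides c (a+1≡ c e e+1≡)) }) ]′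
    (p^n∣uv⇒p^n∣u⊎p^n∣v prime[2] k e (e + + 1) 2∤1 (divides Q e[e+1]≡))
    where
    g = + (2 ^ k)
    2^[1+k]≡ : + (2 ^ suc k) ≡ + 2 * g
    2^[1+k]≡ = ℤP.pos-* 2 (2 ^ k)
    2^[2+k]≡ : + (2 ^ (2 ℕ.+ k)) ≡ + 4 * g
    2^[2+k]≡ = trans (ℤP.pos-* 2 (2 ^ suc k)) (trans (cong (+ 2 *_) 2^[1+k]≡) (sym (ℤP.*-assoc (+ 2) (+ 2) g)))
    e[e+1]≡ : e * (e + + 1) ≡ Q * g
    e[e+1]≡ = ℤP.*-cancelˡ-≡ (+ 4) _ _ (trans (by-ring₁ e) (trans a²-1≡ (trans (cong (Q *_) 2^[2+k]≡) (by-ring₂ Q g))))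
      where
      by-ring₁ : ∀ e → + 4 * (e * (e + + 1)) ≡ (+ 1 + e * + 2) * (+ 1 + e * + 2) - + 1
      by-ring₁ = solve-∀
      by-ring₂ : ∀ Q g → Q * (+ 4 * g) ≡ + 4 * (Q * g)
      by-ring₂ = solve-∀
    e+1-e≡1 : ∀ e → (e + + 1) - e ≡ + 1
    e+1-e≡1 = solve-∀
    2∤1 : ¬ (+ 2 ∣ (e + + 1) - e)
    2∤1 2∣1 with ℕ∣.∣1⇒≡1 (∣⇒∣ᵤ (subst (+ 2 ∣_) (e+1-e≡1 e) 2∣1))
    ... | ()
    a-1≡ : ∀ c e → e ≡ c * g → (+ 1 + e * + 2) - + 1 ≡ c * + (2 ^ suc k)
    a-1≡ c _ refl = trans (by-ring c g) (cong (c *_) (sym 2^[1+k]≡))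
      where
      by-ring : ∀ c g → (+ 1 + c * g * + 2) - + 1 ≡ c * (+ 2 * g)
      by-ring = solve-∀
    a+1≡ : ∀ c e → e + + 1 ≡ c * g → (+ 1 + e * + 2) + + 1 ≡ c * + (2 ^ suc k)
    a+1≡ c e e+1≡ = trans (by-ring e) (trans (cong (_* + 2) e+1≡) (trans (by-ring′ c g) (cong (c *_) (sym 2^[1+k]≡))))
      where
      by-ring : ∀ e → (+ 1 + e * + 2) + + 1 ≡ (e + + 1) * + 2
      by-ring = solve-∀
      by-ring′ : ∀ c g → c * g * + 2 ≡ c * (+ 2 * g)
      by-ring′ = solve-∀

  2^[2+k]∣a²-1⇒a≡±1,2^[1+k]±1 : ∀ k a → Coprime ∣ a ∣ (2 ^ (2 ℕ.+ k)) → + (2 ^ (2 ℕ.+ k)) ∣ a * a - + 1 →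
    (+ (2 ^ (2 ℕ.+ k)) ∣ a - + 1) ⊎ (+ (2 ^ (2 ℕ.+ k)) ∣ a + + 1)
    ⊎ (+ (2 ^ (2 ℕ.+ k)) ∣ a - (+ (2 ^ suc k) + + 1)) ⊎ (+ (2 ^ (2 ℕ.+ k)) ∣ a - (+ (2 ^ suc k) - + 1))
  2^[2+k]∣a²-1⇒a≡±1,2^[1+k]±1 k a coprime N∣a²-1
    with coprime-2^[1+n]⇒odd (suc k) a coprime
  ... | e , a≡ with 2^[2+k]∣a²-1⇒a≡±1 k a e a≡ N∣a²-1
  ...   | inj₁ H∣a-1 with h∣x⇒2h∣x⊎2h∣x-h (2 ^ suc k) _ H∣a-1
  ...     | inj₁ N∣a-1   = inj₁ N∣a-1
  ...     | inj₂ N∣a-1-H = inj₂ (inj₂ (inj₁ (subst (_ ∣_) (by-ring₁ a _) N∣a-1-H)))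
    where
    by-ring₁ : ∀ a h → a - + 1 - h ≡ a - (h + + 1)
    by-ring₁ = solve-∀
  2^[2+k]∣a²-1⇒a≡±1,2^[1+k]±1 k a coprime N∣a²-1
      | e , a≡ | inj₂ H∣a+1 with h∣x⇒2h∣x⊎2h∣x-h (2 ^ suc k) _ H∣a+1
  ...     | inj₁ N∣a+1   = inj₂ (inj₁ N∣a+1)
  ...     | inj₂ N∣a+1-H = inj₂ (inj₂ (inj₂ (subst (_ ∣_) (by-ring₂ a _) N∣a+1-H)))
    where
    by-ring₂ : ∀ a h → a + + 1 - h ≡ a - (h - + 1)
    by-ring₂ = solve-∀

module CoefficientSequences where

  open import Defs
  open import Data.Nat as ℕ using (ℕ; zero; suc)
  import Data.Nat.Properties as ℕP
  open import Data.Integer as ℤ using (ℤ; +_; -[1+_]; _+_; _*_; -_; _-_)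
  open import Data.Integer.Properties
  open import Algebra.Properties.CommutativeSemigroup +-commutativeSemigroup using (interchange)
  open import Data.Integer.Tactic.RingSolver using (solve-∀)
  open import Data.List using ([]; _∷_)
  open import Relation.Binary.PropositionalEquality

  -- Polynomials are handled through their coefficient sequences indexed by all of ℤ (zero at negative
  -- indices), so that shifts i ↦ i − k and reflections i ↦ N − i are total.
  Coeffs : Set
  Coeffs = ℤ → ℤ

  coeff : Poly → Coeffs
  coeff [] i = + 0
  coeff (x ∷ f) (+ zero) = x
  coeff (x ∷ f) (+ suc n) = coeff f (+ n)
  coeff (x ∷ f) -[1+ n ] = + 0

  infixl 6 _⊕_
  _⊕_ : Coeffs → Coeffs → Coeffs
  (F ⊕ G) i = F i + G i

  neg : Coeffs → Coeffs
  neg F i = - F i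

  shift : ℕ → Coeffs → Coeffs
  shift k F i = F (i - + k)

  qint· : ℕ → Coeffs → Coeffs
  qint· zero F i = + 0
  qint· (suc c) F i = F i + qint· c F (i - + 1)

  δ : Coeffs
  δ = coeff (+ 1 ∷ [])

  i-a-b≡i-[a+b] : ∀ i a b → i - + a - + b ≡ i - + (a ℕ.+ b)
  i-a-b≡i-[a+b] i a b = trans (by-ring i (+ a) (+ b)) (cong (_-_ i) (sym (pos-+ a b)))
    where
    by-ring : ∀ i a b → i - a - b ≡ i - (a + b)
    by-ring = solve-∀

  i-a-b≡i-b-a : ∀ i a b → i - a - b ≡ i - b - a
  i-a-b≡i-b-a = solve-∀

  coeff-negative : ∀ f n → coeff f -[1+ n ] ≡ + 0
  coeff-negative [] n = refl
  coeff-negative (x ∷ f) n = refl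

  coeff-+P : ∀ f g i → coeff (f +P g) i ≡ coeff f i + coeff g i
  coeff-+P [] g i = sym (+-identityˡ _)
  coeff-+P (x ∷ f) [] i = sym (+-identityʳ _)
  coeff-+P (x ∷ f) (y ∷ g) (+ zero) = refl
  coeff-+P (x ∷ f) (y ∷ g) (+ suc n) = coeff-+P f g (+ n)
  coeff-+P (x ∷ f) (y ∷ g) -[1+ n ] = refl

  coeff-negP : ∀ f i → coeff (negP f) i ≡ - coeff f i
  coeff-negP [] i = refl
  coeff-negP (x ∷ f) (+ zero) = refl
  coeff-negP (x ∷ f) (+ suc n) = coeff-negP f (+ n)
  coeff-negP (x ∷ f) -[1+ n ] = refl

  coeff-scaleP : ∀ c f i → coeff (scaleP c f) i ≡ c * coeff f i
  coeff-scaleP c [] i = sym (*-zeroʳ c)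
  coeff-scaleP c (x ∷ f) (+ zero) = refl
  coeff-scaleP c (x ∷ f) (+ suc n) = coeff-scaleP c f (+ n)
  coeff-scaleP c (x ∷ f) -[1+ n ] = sym (*-zeroʳ c)

  coeff-0∷ : ∀ f i → coeff (+ 0 ∷ f) i ≡ coeff f (i - + 1)
  coeff-0∷ f (+ zero) = sym (coeff-negative f 0)
  coeff-0∷ f (+ suc n) = refl
  coeff-0∷ f -[1+ n ] = sym (coeff-negative f _)

  coeff-shiftP : ∀ k f i → coeff (shiftP k f) i ≡ coeff f (i - + k)
  coeff-shiftP zero f i = cong (coeff f) (sym (+-identityʳ i))
  coeff-shiftP (suc k) f i =
    trans (coeff-0∷ (shiftP k f) i) (trans (coeff-shiftP k f (i - + 1)) (cong (coeff f) (i-a-b≡i-[a+b] i 1 k)))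

  coeff-qint*P : ∀ c f i → coeff (qint c *P f) i ≡ qint· c (coeff f) i
  coeff-qint*P zero f i = refl
  coeff-qint*P (suc c) f i = trans (coeff-+P (scaleP (+ 1) f) (+ 0 ∷ (qint c *P f)) i)
    (cong₂ _+_ (trans (coeff-scaleP (+ 1) f i) (*-identityˡ _))
               (trans (coeff-0∷ (qint c *P f) i) (coeff-qint*P c f (i - + 1))))

  coeff-qint : ∀ c i → coeff (qint c) i ≡ qint· c δ i
  coeff-qint c i = trans (cong (λ f → coeff f i) (sym (qint*P[1] c))) (coeff-qint*P c (+ 1 ∷ []) i)
    where
    qint*P[1] : ∀ c → qint c *P (+ 1 ∷ []) ≡ qint c
    qint*P[1] zero = refl
    qint*P[1] (suc c) = cong (+ 1 ∷_) (qint*P[1] c)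

  qint·-cong : ∀ c {F G : Coeffs} → (∀ i → F i ≡ G i) → ∀ i → qint· c F i ≡ qint· c G i
  qint·-cong zero F≡G i = refl
  qint·-cong (suc c) F≡G i = cong₂ _+_ (F≡G i) (qint·-cong c F≡G (i - + 1))

  qint·-negative : ∀ c F → (∀ n → F -[1+ n ] ≡ + 0) → ∀ n → qint· c F -[1+ n ] ≡ + 0
  qint·-negative zero F F<0 n = refl
  qint·-negative (suc c) F F<0 n = cong₂ _+_ (F<0 n) (qint·-negative c F F<0 _)

  qint·-⊕ : ∀ c F G i → qint· c (F ⊕ G) i ≡ qint· c F i + qint· c G i
  qint·-⊕ zero F G i = refl
  qint·-⊕ (suc c) F G i rewrite qint·-⊕ c F G (i - + 1) =
    interchange (F i) (G i) (qint· c F (i - + 1)) (qint· c G (i - + 1))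

  qint·-neg : ∀ c F i → qint· c (neg F) i ≡ - qint· c F i
  qint·-neg zero F i = refl
  qint·-neg (suc c) F i rewrite qint·-neg c F (i - + 1) = sym (neg-distrib-+ (F i) _)

  qint·-shift : ∀ c k F i → qint· c (shift k F) i ≡ qint· c F (i - + k)
  qint·-shift zero k F i = refl
  qint·-shift (suc c) k F i =
    cong (_+_ (F (i - + k))) (trans (qint·-shift c k F (i - + 1)) (cong (qint· c F) (i-a-b≡i-b-a i (+ 1) (+ k))))

  qint·-1 : ∀ F i → qint· 1 F i ≡ F i
  qint·-1 F i = +-identityʳ (F i)

  qint·-suc : ∀ c F i → qint· (suc c) F i ≡ qint· c F i + F (i - + c)
  qint·-suc zero F i = trans (qint·-1 F i) (trans (cong F (sym (+-identityʳ i))) (sym (+-identityˡ _)))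
  qint·-suc (suc c) F i = trans (cong (_+_ (F i)) (qint·-suc c F (i - + 1)))
    (trans (sym (+-assoc (F i) _ _)) (cong (λ j → qint· (suc c) F i + F j) (i-a-b≡i-[a+b] i 1 c)))

  qint·-comm : ∀ a b F i → qint· a (qint· b F) i ≡ qint· b (qint· a F) i
  qint·-comm zero b F i = sym (qint·-zero b i)
    where
    qint·-zero : ∀ c i → qint· c (λ _ → + 0) i ≡ + 0
    qint·-zero zero i = refl
    qint·-zero (suc c) i = trans (+-identityˡ _) (qint·-zero c (i - + 1))
  qint·-comm (suc a) b F i = begin
    qint· b F i + qint· a (qint· b F) (i - + 1)   ≡⟨ cong (_+_ (qint· b F i)) (qint·-comm a b F (i - + 1)) ⟩
    qint· b F i + qint· b (qint· a F) (i - + 1)   ≡⟨ cong (_+_ (qint· b F i)) (sym (qint·-shift b 1 (qint· a F) i)) ⟩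
    qint· b F i + qint· b (shift 1 (qint· a F)) i ≡⟨ sym (qint·-⊕ b F (shift 1 (qint· a F)) i) ⟩
    qint· b (F ⊕ shift 1 (qint· a F)) i           ∎
    where open ≡-Reasoning

  [2][1+c]-q[c]≡[2+c] : ∀ c F i → qint· 2 (qint· (suc c) F) i - qint· c F (i - + 1) ≡ qint· (2 ℕ.+ c) F i
  [2][1+c]-q[c]≡[2+c] c F i = begin
    qint· (suc c) F i + (qint· (suc c) F (i - + 1) + + 0) - qint· c F (i - + 1)
      ≡⟨ cong (λ u → qint· (suc c) F i + (u + + 0) - qint· c F (i - + 1)) (qint·-suc c F (i - + 1)) ⟩
    qint· (suc c) F i + (qint· c F (i - + 1) + F (i - + 1 - + c) + + 0) - qint· c F (i - + 1)
      ≡⟨ by-ring (qint· (suc c) F i) (qint· c F (i - + 1)) (F (i - + 1 - + c)) ⟩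
    qint· (suc c) F i + F (i - + 1 - + c)
      ≡⟨ cong (λ j → qint· (suc c) F i + F j) (i-a-b≡i-[a+b] i 1 c) ⟩
    qint· (suc c) F i + F (i - + suc c)
      ≡⟨ sym (qint·-suc (suc c) F i) ⟩
    qint· (2 ℕ.+ c) F i ∎
    where
    open ≡-Reasoning
    by-ring : ∀ a b c → a + (b + c + + 0) - b ≡ a + c
    by-ring = solve-∀

  Palindrome : ℕ → Coeffs → Set
  Palindrome N F = ∀ i → F i ≡ F (+ N - i)

  Palindrome-ext : ∀ {N F G} → (∀ i → F i ≡ G i) → Palindrome N F → Palindrome N G
  Palindrome-ext F≡G pal i = trans (sym (F≡G i)) (trans (pal i) (F≡G _))

  Palindrome-cast : ∀ {N M F} → N ≡ M → Palindrome N F → Palindrome M F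
  Palindrome-cast refl pal = pal

  Palindrome-⊕ : ∀ {N F G} → Palindrome N F → Palindrome N G → Palindrome N (F ⊕ G)
  Palindrome-⊕ palF palG i = cong₂ _+_ (palF i) (palG i)

  Palindrome-neg : ∀ {N F} → Palindrome N F → Palindrome N (neg F)
  Palindrome-neg pal i = cong -_ (pal i)

  Palindrome-δ : Palindrome 0 δ
  Palindrome-δ (+ zero) = refl
  Palindrome-δ (+ suc n) = refl
  Palindrome-δ -[1+ n ] = refl

  Palindrome-shift : ∀ {N F} k → Palindrome N F → Palindrome (N ℕ.+ 2 ℕ.* k) (shift k F)
  Palindrome-shift {N} {F} k pal i = trans (pal (i - + k))
    (cong F (trans (by-ring (+ N) (+ k) i) (cong (λ M → M - i - + k) (sym (pos-+ N (2 ℕ.* k))))))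
    where
    by-ring : ∀ N k i → N - (i - k) ≡ N + (k + (k + + 0)) - i - k
    by-ring = solve-∀

  Palindrome-qint· : ∀ {N F} c → Palindrome N F → Palindrome (N ℕ.+ c) (qint· (suc c) F)
  Palindrome-qint· {N} {F} zero pal i =
    trans (qint·-1 F i) (trans (pal i) (trans (cong (λ M → F (+ M - i)) (sym (ℕP.+-identityʳ N))) (sym (qint·-1 F _))))
  Palindrome-qint· {N} {F} (suc c) pal i = begin
    F i + qint· (suc c) F (i - + 1)                      ≡⟨ cong₂ _+_ (pal i) (Palindrome-qint· c pal (i - + 1)) ⟩
    F (+ N - i) + qint· (suc c) F (+ (N ℕ.+ c) - (i - + 1)) ≡⟨ cong₂ (λ u v → F u + qint· (suc c) F v) index₁ index₂ ⟩
    F (M - i - + suc c) + qint· (suc c) F (M - i)         ≡⟨ +-comm (F (M - i - + suc c)) (qint· (suc c) F (M - i)) ⟩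
    qint· (suc c) F (M - i) + F (M - i - + suc c)         ≡⟨ sym (qint·-suc (suc c) F (M - i)) ⟩
    qint· (2 ℕ.+ c) F (M - i)                             ∎
    where
    open ≡-Reasoning
    M = + (N ℕ.+ suc c)
    index₁ : + N - i ≡ M - i - + suc c
    index₁ = trans (by-ring (+ N) i (+ c)) (cong (λ u → u - i - + suc c) (sym (pos-+ N (suc c))))
      where
      by-ring : ∀ N i c → N - i ≡ N + (+ 1 + c) - i - (+ 1 + c)
      by-ring = solve-∀
    index₂ : + (N ℕ.+ c) - (i - + 1) ≡ M - i
    index₂ = trans (cong (_- (i - + 1)) (pos-+ N c)) (trans (by-ring (+ N) i (+ c)) (cong (_- i) (sym (pos-+ N (suc c)))))
      where
      by-ring : ∀ N i c → N + c - (i - + 1) ≡ N + (+ 1 + c) - i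
      by-ring = solve-∀

module PalindromeCriterion where

  open import Defs
  open CoefficientSequences
  open import Data.Nat as ℕ using (ℕ; zero; suc; _≤_; _<_; s≤s)
  import Data.Nat.Properties as ℕP
  open import Data.Integer as ℤ using (ℤ; +_; -[1+_]; _+_; -_; _-_)
  open import Data.Integer.Properties
  open import Data.Integer.Tactic.RingSolver using (solve-∀)
  open import Data.List using (List; []; _∷_; reverse; _++_; length; [_])
  open import Data.List.Properties using (length-reverse; unfold-reverse)
  open import Data.Bool using (if_then_else_)
  open import Data.Empty using (⊥-elim)
  open import Relation.Binary.Definitions using (tri<; tri≈; tri>)
  open import Relation.Binary.PropositionalEquality hiding ([_])

  _∷ₛ_ : ℤ → Poly → Poly
  x ∷ₛ [] = if isZeroℤ x then [] else x ∷ []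
  x ∷ₛ (y ∷ g) = x ∷ y ∷ g

  strip-∷ : ∀ x f → strip (x ∷ f) ≡ x ∷ₛ strip f
  strip-∷ x f with strip f
  ... | [] = refl
  ... | y ∷ g = refl

  0∷ₛ[] : ∀ {x} → x ≡ + 0 → x ∷ₛ [] ≡ []
  0∷ₛ[] refl = refl

  coeff-ext⇒≈P : ∀ f g → (∀ n → coeff f (+ n) ≡ coeff g (+ n)) → f ≈P g
  coeff-ext⇒≈P [] [] f≡g = refl
  coeff-ext⇒≈P [] (y ∷ g) f≡g =
    sym (trans (strip-∷ y g) (trans (cong (y ∷ₛ_) (sym (coeff-ext⇒≈P [] g (λ n → f≡g (suc n))))) (0∷ₛ[] (sym (f≡g 0)))))
  coeff-ext⇒≈P (x ∷ f) [] f≡g =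
    trans (strip-∷ x f) (trans (cong (x ∷ₛ_) (coeff-ext⇒≈P f [] (λ n → f≡g (suc n)))) (0∷ₛ[] (f≡g 0)))
  coeff-ext⇒≈P (x ∷ f) (y ∷ g) f≡g =
    trans (strip-∷ x f) (trans (cong₂ _∷ₛ_ (f≡g 0) (coeff-ext⇒≈P f g (λ n → f≡g (suc n)))) (sym (strip-∷ y g)))

  coeff-∷ₛ : ∀ x f i → coeff (x ∷ₛ f) i ≡ coeff (x ∷ f) i
  coeff-∷ₛ (+ zero) [] (+ zero) = refl
  coeff-∷ₛ (+ zero) [] (+ suc n) = refl
  coeff-∷ₛ (+ zero) [] -[1+ n ] = refl
  coeff-∷ₛ (+ suc k) [] i = refl
  coeff-∷ₛ -[1+ k ] [] i = refl
  coeff-∷ₛ x (y ∷ g) i = refl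

  coeff-∷-cong : ∀ x {f g} → (∀ i → coeff f i ≡ coeff g i) → ∀ i → coeff (x ∷ f) i ≡ coeff (x ∷ g) i
  coeff-∷-cong x f≡g (+ zero) = refl
  coeff-∷-cong x f≡g (+ suc n) = f≡g (+ n)
  coeff-∷-cong x f≡g -[1+ n ] = refl

  coeff-strip : ∀ f i → coeff (strip f) i ≡ coeff f i
  coeff-strip [] i = refl
  coeff-strip (x ∷ f) i = trans (cong (λ g → coeff g i) (strip-∷ x f))
    (trans (coeff-∷ₛ x (strip f) i) (coeff-∷-cong x (coeff-strip f) i))

  LeadingNonzero : Poly → Set
  LeadingNonzero f = ∀ n → length f ≡ suc n → coeff f (+ n) ≢ + 0

  LeadingNonzero-∷ₛ : ∀ x f → LeadingNonzero f → LeadingNonzero (x ∷ₛ f)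
  LeadingNonzero-∷ₛ (+ zero) [] _ n ()
  LeadingNonzero-∷ₛ (+ suc k) [] _ zero refl ()
  LeadingNonzero-∷ₛ -[1+ k ] [] _ zero refl ()
  LeadingNonzero-∷ₛ x (y ∷ g) lead (suc n) len≡ = lead n (ℕP.suc-injective len≡)

  LeadingNonzero-strip : ∀ f → LeadingNonzero (strip f)
  LeadingNonzero-strip [] n ()
  LeadingNonzero-strip (x ∷ f) =
    subst LeadingNonzero (sym (strip-∷ x f)) (LeadingNonzero-∷ₛ x (strip f) (LeadingNonzero-strip f))

  coeff-≥length : ∀ f n → length f ≤ n → coeff f (+ n) ≡ + 0
  coeff-≥length [] n _ = refl
  coeff-≥length (x ∷ f) (suc n) (s≤s len≤n) = coeff-≥length f n len≤n

  coeff-++ : ∀ f g i → coeff (f ++ g) i ≡ coeff f i + coeff g (i - + length f)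
  coeff-++ [] g i = trans (cong (coeff g) (sym (+-identityʳ i))) (sym (+-identityˡ _))
  coeff-++ (x ∷ f) g (+ zero) = sym (trans (cong (_+_ x) (coeff-negative g _)) (+-identityʳ x))
  coeff-++ (x ∷ f) g (+ suc n) =
    trans (coeff-++ f g (+ n)) (cong (λ j → coeff f (+ n) + coeff g j) (by-ring (+ n) (+ length f)))
    where
    by-ring : ∀ a b → a - b ≡ (+ 1 + a) - (+ 1 + b)
    by-ring = solve-∀
  coeff-++ (x ∷ f) g -[1+ n ] = sym (trans (+-identityˡ _) (coeff-negative g _))

  coeff-∷ : ∀ x f i → coeff (x ∷ f) i ≡ coeff [ x ] i + coeff f (i - + 1)
  coeff-∷ x f (+ zero) = sym (trans (cong (_+_ x) (coeff-negative f 0)) (+-identityʳ x))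
  coeff-∷ x f (+ suc n) = sym (+-identityˡ _)
  coeff-∷ x f -[1+ n ] = sym (trans (+-identityˡ _) (coeff-negative f _))

  coeff-[x]-reflect : ∀ x i → coeff [ x ] i ≡ coeff [ x ] (- i)
  coeff-[x]-reflect x (+ zero) = refl
  coeff-[x]-reflect x (+ suc n) = refl
  coeff-[x]-reflect x -[1+ n ] = refl

  coeff-reverse : ∀ f i → coeff (reverse f) i ≡ coeff f (+ length f - + 1 - i)
  coeff-reverse [] i = refl
  coeff-reverse (x ∷ f) i = begin
    coeff (reverse (x ∷ f)) i                       ≡⟨ cong (λ g → coeff g i) (unfold-reverse x f) ⟩
    coeff (reverse f ++ [ x ]) i                    ≡⟨ coeff-++ (reverse f) [ x ] i ⟩
    coeff (reverse f) i + coeff [ x ] (i - + length (reverse f))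
      ≡⟨ cong₂ (λ u v → u + coeff [ x ] (i - + v)) (coeff-reverse f i) (length-reverse f) ⟩
    coeff f (l - + 1 - i) + coeff [ x ] (i - l)     ≡⟨ +-comm (coeff f (l - + 1 - i)) (coeff [ x ] (i - l)) ⟩
    coeff [ x ] (i - l) + coeff f (l - + 1 - i)
      ≡⟨ cong₂ (λ u v → coeff [ x ] u + coeff f v) (by-ring₁ l i) (by-ring₂ l i) ⟩
    coeff [ x ] (- (l - i)) + coeff f (l - i - + 1)  ≡⟨ cong (_+ coeff f (l - i - + 1)) (sym (coeff-[x]-reflect x (l - i))) ⟩
    coeff [ x ] (l - i) + coeff f (l - i - + 1)      ≡⟨ sym (coeff-∷ x f (l - i)) ⟩
    coeff (x ∷ f) (l - i)                           ≡⟨ cong (coeff (x ∷ f)) (by-ring₃ l i) ⟩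
    coeff (x ∷ f) (+ length (x ∷ f) - + 1 - i)      ∎
    where
    open ≡-Reasoning
    l = + length f
    by-ring₁ : ∀ l i → i - l ≡ - (l - i)
    by-ring₁ = solve-∀
    by-ring₂ : ∀ l i → l - + 1 - i ≡ l - i - + 1
    by-ring₂ = solve-∀
    by-ring₃ : ∀ l i → l - i ≡ (+ 1 + l) - + 1 - i
    by-ring₃ = solve-∀

  coeff-ext⇒≡ : ∀ f g → length f ≡ length g → (∀ n → coeff f (+ n) ≡ coeff g (+ n)) → f ≡ g
  coeff-ext⇒≡ [] [] _ _ = refl
  coeff-ext⇒≡ (x ∷ f) (y ∷ g) len≡ f≡g =
    cong₂ _∷_ (f≡g 0) (coeff-ext⇒≡ f g (ℕP.suc-injective len≡) (λ n → f≡g (suc n)))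

  -- Symmetry about N/2 forces the degree to be N: a lower degree would kill the constant term,
  -- a higher one the leading coefficient.
  reverse≡-from-coeffs : ∀ f N → Palindrome N (coeff f) → coeff f (+ 0) ≢ + 0 → LeadingNonzero f → reverse f ≡ f
  reverse≡-from-coeffs [] N _ f₀≢0 _ = ⊥-elim (f₀≢0 refl)
  reverse≡-from-coeffs f@(x ∷ f′) N pal f₀≢0 lead with ℕP.<-cmp (length f′) N
  ... | tri< n<N _ _ = ⊥-elim (f₀≢0 (begin
    coeff f (+ 0)     ≡⟨ cong (coeff f) (sym (+-inverseʳ (+ N))) ⟩
    coeff f (+ N - + N) ≡⟨ sym (pal (+ N)) ⟩
    coeff f (+ N)     ≡⟨ coeff-≥length f N n<N ⟩
    + 0               ∎))
    where open ≡-Reasoning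
  ... | tri> _ _ N<n = ⊥-elim (lead n refl (begin
    coeff f (+ n)         ≡⟨ pal (+ n) ⟩
    coeff f (+ N - + n)   ≡⟨ cong (coeff f) (trans (m-n≡m⊖n N n) (⊖-< N<n)) ⟩
    coeff f (- + (n ℕ.∸ N)) ≡⟨ negative (n ℕ.∸ N) (ℕP.m<n⇒0<n∸m N<n) ⟩
    + 0                   ∎))
    where
    open ≡-Reasoning
    n = length f′
    negative : ∀ k → 0 < k → coeff f (- + k) ≡ + 0
    negative (suc k) _ = coeff-negative f k
  ... | tri≈ _ refl _ = coeff-ext⇒≡ (reverse f) f (length-reverse f)
    (λ k → trans (coeff-reverse f (+ k)) (trans (cong (coeff f) (by-ring (+ N) (+ k))) (sym (pal (+ k)))))
    where
    by-ring : ∀ n k → (+ 1 + n) - + 1 - k ≡ n - k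
    by-ring = solve-∀

  palindromic-from-coeffs : ∀ f N → Palindrome N (coeff f) → coeff f (+ 0) ≢ + 0 → Palindromic f
  palindromic-from-coeffs f N pal f₀≢0 = reverse≡-from-coeffs (strip f) N
    (λ i → trans (coeff-strip f i) (trans (pal i) (sym (coeff-strip f _))))
    (λ g₀≡0 → f₀≢0 (trans (sym (coeff-strip f (+ 0))) g₀≡0))
    (LeadingNonzero-strip f)

module Expansions where

  open import Defs
  open NegativeContinuedFraction using (ncf-stop; ncf-step)
  open import Data.Nat using (zero; suc; _+_; _*_; _∸_; _≤_; _<_; s≤s; z≤n; NonZero)
  open import Data.Nat.Properties
  open import Data.Nat.DivMod using (_/_; m<n⇒m/n≡0; m*n/n≡m; +-distrib-/-∣ʳ)
  open import Data.Nat.Divisibility using (n∣m*n)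
  open import Data.Nat.Tactic.RingSolver using (solve-∀)
  open import Data.List using ([]; _∷_; replicate; _++_)
  open import Relation.Binary.PropositionalEquality

  [d+cs]/s≡c : ∀ {d s} c .{{_ : NonZero s}} → d < s → (d + c * s) / s ≡ c
  [d+cs]/s≡c {d} {s} c d<s =
    trans (+-distrib-/-∣ʳ d (n∣m*n c)) (cong₂ _+_ (m<n⇒m/n≡0 d<s) (m*n/n≡m c s))

  ncf-unfold-last : ∀ f r s′ c → r ≡ c * suc s′ → ncf (suc f) r (suc s′) ≡ c ∷ []
  ncf-unfold-last f r s′ c r≡ = ncf-stop f r s′ quotient (sym r≡)
    where
    quotient : (r + s′) / suc s′ ≡ c
    quotient = trans (cong (λ u → (u + s′) / suc s′) r≡)
                     (trans (cong (_/ suc s′) (+-comm (c * suc s′) s′)) ([d+cs]/s≡c {s′} c ≤-refl))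

  ncf-unfold : ∀ f r s′ c t → r + suc t ≡ c * suc s′ → t < s′ →
               ncf (suc f) r (suc s′) ≡ c ∷ ncf f (suc s′) (suc t)
  ncf-unfold f r s′ c t r+1+t≡ t<s′ =
    trans (ncf-step f r s′ quotient cs≢r) (cong (λ u → c ∷ ncf f (suc s′) u) remainder)
    where
    d = s′ ∸ suc t
    r+s′≡ : r + s′ ≡ d + c * suc s′
    r+s′≡ = begin
      r + s′           ≡⟨ cong (r +_) (sym (m+[n∸m]≡n t<s′)) ⟩
      r + (suc t + d)  ≡⟨ sym (+-assoc r (suc t) d) ⟩
      r + suc t + d    ≡⟨ cong (_+ d) r+1+t≡ ⟩
      c * suc s′ + d   ≡⟨ +-comm (c * suc s′) d ⟩
      d + c * suc s′   ∎
      where open ≡-Reasoning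
    quotient : (r + s′) / suc s′ ≡ c
    quotient = trans (cong (_/ suc s′) r+s′≡) ([d+cs]/s≡c c (s≤s (m∸n≤m s′ (suc t))))
    remainder : c * suc s′ ∸ r ≡ suc t
    remainder = trans (cong (_∸ r) (sym r+1+t≡)) (m+n∸m≡n r (suc t))
    cs≢r : c * suc s′ ≢ r
    cs≢r cs≡r = 1+n≢0 (trans (sym remainder) (trans (cong (_∸ r) cs≡r) (n∸n≡0 r)))

  ncf-[1+m]/m : ∀ m f → m ≤ f → ncf f (suc m) m ≡ replicate m 2
  ncf-[1+m]/m zero zero _ = refl
  ncf-[1+m]/m zero (suc f) _ = refl
  ncf-[1+m]/m (suc zero) (suc f) _ = refl
  ncf-[1+m]/m (suc (suc m)) (suc f) (s≤s m<f) =
    trans (ncf-unfold f (3 + m) (suc m) 2 m (by-ring m) ≤-refl) (cong (2 ∷_) (ncf-[1+m]/m (suc m) f m<f))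
    where
    by-ring : ∀ m → 3 + m + suc m ≡ 2 * (2 + m)
    by-ring = solve-∀

  ncf-m/1 : ∀ f m → ncf (suc f) m 1 ≡ m ∷ []
  ncf-m/1 f m = ncf-unfold-last f m 0 m (sym (*-identityʳ m))

  ncf-4h/[2h+1] : ∀ w f → ncf (3 + f) (4 * suc w) (1 + 2 * suc w) ≡ 2 ∷ 2 + w ∷ 2 ∷ []
  ncf-4h/[2h+1] w f = begin
    ncf (3 + f) (4 * suc w) (1 + 2 * suc w)
      ≡⟨ ncf-unfold (2 + f) (4 * suc w) (2 * suc w) 2 1 (by-ring₁ w) (*-monoʳ-≤ 2 (s≤s z≤n)) ⟩
    2 ∷ ncf (2 + f) (1 + 2 * suc w) 2
      ≡⟨ cong (2 ∷_) (ncf-unfold (suc f) (1 + 2 * suc w) 1 (2 + w) 0 (by-ring₂ w) ≤-refl) ⟩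
    2 ∷ 2 + w ∷ ncf (suc f) 2 1
      ≡⟨ cong (λ u → 2 ∷ 2 + w ∷ u) (ncf-m/1 f 2) ⟩
    2 ∷ 2 + w ∷ 2 ∷ [] ∎
    where
    open ≡-Reasoning
    by-ring₁ : ∀ w → 4 * suc w + 2 ≡ 2 * (1 + 2 * suc w)
    by-ring₁ = solve-∀
    by-ring₂ : ∀ w → 1 + 2 * suc w + 1 ≡ (2 + w) * 2
    by-ring₂ = solve-∀

  ncf-[3+2v]/[1+2v] : ∀ v f → v < f → ncf f (3 + 2 * v) (1 + 2 * v) ≡ replicate v 2 ++ 3 ∷ []
  ncf-[3+2v]/[1+2v] zero (suc f) _ = refl
  ncf-[3+2v]/[1+2v] (suc v) (suc f) (s≤s v<f) = begin
    ncf (suc f) (3 + 2 * suc v) (1 + 2 * suc v)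
      ≡⟨ cong (λ u → ncf (suc f) (3 + u) (1 + u)) (*-suc 2 v) ⟩
    ncf (suc f) (5 + 2 * v) (3 + 2 * v)
      ≡⟨ ncf-unfold f (5 + 2 * v) (2 + 2 * v) 2 (2 * v) (by-ring₁ v) (m≤n+m (suc (2 * v)) 1) ⟩
    2 ∷ ncf f (3 + 2 * v) (1 + 2 * v)
      ≡⟨ cong (2 ∷_) (ncf-[3+2v]/[1+2v] v f v<f) ⟩
    replicate (suc v) 2 ++ 3 ∷ [] ∎
    where
    open ≡-Reasoning
    by-ring₁ : ∀ v → 5 + 2 * v + suc (2 * v) ≡ 2 * (3 + 2 * v)
    by-ring₁ = solve-∀

  ncf-4h/[2h-1] : ∀ v f → ncf (2 + v + f) (4 * (2 + v)) (3 + 2 * v) ≡ 3 ∷ replicate v 2 ++ 3 ∷ []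
  ncf-4h/[2h-1] v f =
    trans (ncf-unfold (suc v + f) (4 * (2 + v)) (2 + 2 * v) 3 (2 * v) (by-ring v) (m≤n+m (suc (2 * v)) 1))
          (cong (3 ∷_) (ncf-[3+2v]/[1+2v] v (suc v + f) (m≤m+n (suc v) f)))
    where
    by-ring : ∀ v → 4 * (2 + v) + suc (2 * v) ≡ 3 * suc (2 + 2 * v)
    by-ring = solve-∀

module WordPolynomials where

  open import Defs
  open CoefficientSequences
  open PalindromeCriterion using (palindromic-from-coeffs)
  open import Data.Nat as ℕ using (ℕ; zero; suc; _≤_; s≤s; z≤n)
  import Data.Nat.Properties as ℕP
  open import Data.Nat.Tactic.RingSolver as ℕ-Solver using ()
  open import Data.Integer as ℤ using (+_; -[1+_]; _+_; -_; _-_)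
  open import Data.Integer.Properties
  open import Data.Integer.Tactic.RingSolver using (solve-∀)
  open import Data.List using (List; []; _∷_; replicate; _++_)
  open import Data.List.Relation.Unary.All using (All; []; _∷_)
  open import Data.Product using (_×_; _,_; proj₁; proj₂)
  open import Relation.Binary.PropositionalEquality

  Rᶜ : List ℕ → Coeffs
  Rᶜ w = coeff (proj₁ (RSvec w))

  Sᶜ : List ℕ → Coeffs
  Sᶜ w = coeff (proj₂ (RSvec w))

  S-∷ : ∀ c w → proj₂ (RSvec (c ∷ w)) ≡ proj₁ (RSvec w)
  S-∷ c w with RSvec w
  ... | R , S = refl

  Sᶜ-∷ : ∀ c w i → Sᶜ (c ∷ w) i ≡ Rᶜ w i
  Sᶜ-∷ c w i = cong (λ f → coeff f i) (S-∷ c w)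

  Rᶜ-∷ : ∀ k w i → Rᶜ (suc k ∷ w) i ≡ qint· (suc k) (Rᶜ w) i - Sᶜ w (i - + k)
  Rᶜ-∷ k w i with RSvec w
  ... | R , S = trans (coeff-+P (qint (suc k) *P R) (negP (shiftP k S)) i)
    (cong₂ _+_ (coeff-qint*P (suc k) R i) (trans (coeff-negP (shiftP k S) i) (cong -_ (coeff-shiftP k S i))))

  Rᶜ-0 : ∀ w → All (2 ≤_) w → Rᶜ w (+ 0) ≡ + 1
  Rᶜ-0 [] [] = refl
  Rᶜ-0 (suc zero ∷ w) (s≤s () ∷ _)
  Rᶜ-0 (suc (suc k) ∷ w) (_ ∷ w≥2) = begin
    Rᶜ (2 ℕ.+ k ∷ w) (+ 0)                                  ≡⟨ Rᶜ-∷ (suc k) w (+ 0) ⟩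
    Rᶜ w (+ 0) + qint· (suc k) (Rᶜ w) -[1+ 0 ] - Sᶜ w -[1+ k ]
      ≡⟨ cong₂ (λ a b → a + b - Sᶜ w -[1+ k ]) (Rᶜ-0 w w≥2) (qint·-negative (suc k) (Rᶜ w) (coeff-negative (proj₁ (RSvec w))) 0) ⟩
    + 1 + + 0 - Sᶜ w -[1+ k ]                                ≡⟨ cong (λ z → + 1 + + 0 - z) (coeff-negative (proj₂ (RSvec w)) k) ⟩
    + 1                                                      ∎
    where open ≡-Reasoning

  palindromic-R : ∀ w N → All (2 ≤_) w → Palindrome N (Rᶜ w) → Palindromic (proj₁ (RSvec w))
  palindromic-R w N w≥2 pal = palindromic-from-coeffs (proj₁ (RSvec w)) N pal
    (λ R₀≡0 → 1≢0 (trans (sym (Rᶜ-0 w w≥2)) R₀≡0))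
    where
    1≢0 : + 1 ≢ + 0
    1≢0 ()

  Rᶜ-[c] : ∀ k i → Rᶜ (suc k ∷ []) i ≡ qint· (suc k) δ i
  Rᶜ-[c] k i = trans (Rᶜ-∷ k [] i) (+-identityʳ (qint· (suc k) δ i))

  RSᶜ-2ʲ : ∀ j i → (Rᶜ (replicate j 2) i ≡ qint· (suc j) δ i) × (Sᶜ (replicate j 2) i ≡ qint· j δ i)
  RSᶜ-2ʲ zero i = sym (qint·-1 δ i) , refl
  RSᶜ-2ʲ (suc j) i = R≡ , trans (Sᶜ-∷ 2 (replicate j 2) i) (proj₁ (RSᶜ-2ʲ j i))
    where
    R≡ : Rᶜ (replicate (suc j) 2) i ≡ qint· (suc (suc j)) δ i
    R≡ = trans (Rᶜ-∷ 1 (replicate j 2) i)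
         (trans (cong₂ _-_ (qint·-cong 2 (λ l → proj₁ (RSᶜ-2ʲ j l)) i) (proj₂ (RSᶜ-2ʲ j (i - + 1))))
                ([2][1+c]-q[c]≡[2+c] j δ i))

  1+q² : Coeffs
  1+q² = δ ⊕ shift 2 δ

  Palindrome-1+q² : Palindrome 2 1+q²
  Palindrome-1+q² i = trans (+-comm (δ i) (δ (i - + 2))) (cong₂ _+_ (reflect (i - + 2) (by-ring₁ i)) (reflect i (by-ring₂ i)))
    where
    reflect : ∀ j {k} → + 0 - j ≡ k → δ j ≡ δ k
    reflect j refl = Palindrome-δ j
    by-ring₁ : ∀ i → + 0 - (i - + 2) ≡ + 2 - i
    by-ring₁ = solve-∀
    by-ring₂ : ∀ i → + 0 - i ≡ + 2 - i - + 2
    by-ring₂ = solve-∀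

  Rᶜ-[2,2+w,2] : ∀ w i → Rᶜ (2 ∷ 2 ℕ.+ w ∷ 2 ∷ []) i ≡ qint· 2 (qint· (suc w) 1+q²) i
  Rᶜ-[2,2+w,2] w i = begin
    Rᶜ (2 ∷ 2 ℕ.+ w ∷ 2 ∷ []) i
      ≡⟨ Rᶜ-∷ 1 (2 ℕ.+ w ∷ 2 ∷ []) i ⟩
    qint· 2 (Rᶜ (2 ℕ.+ w ∷ 2 ∷ [])) i - Sᶜ (2 ℕ.+ w ∷ 2 ∷ []) (i - + 1)
      ≡⟨ cong₂ _-_ (qint·-cong 2 R[2+w,2]≡ i) (trans (Sᶜ-∷ (2 ℕ.+ w) (2 ∷ []) (i - + 1)) (Rᶜ-[c] 1 (i - + 1))) ⟩
    qint· 2 (A ⊕ shift 1 δ) i - qint· 2 δ (i - + 1)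
      ≡⟨ cong₂ _-_ (qint·-⊕ 2 A (shift 1 δ) i) (sym (qint·-shift 2 1 δ i)) ⟩
    qint· 2 A i + qint· 2 (shift 1 δ) i - qint· 2 (shift 1 δ) i
      ≡⟨ by-ring (qint· 2 A i) (qint· 2 (shift 1 δ) i) ⟩
    qint· 2 A i ∎
    where
    open ≡-Reasoning
    u = suc w
    A = qint· u 1+q²
    by-ring : ∀ a b → a + b - b ≡ a
    by-ring = solve-∀
    R[2+w,2]≡ : ∀ j → Rᶜ (suc u ∷ 2 ∷ []) j ≡ (A ⊕ shift 1 δ) j
    R[2+w,2]≡ j = begin
      Rᶜ (suc u ∷ 2 ∷ []) j
        ≡⟨ Rᶜ-∷ u (2 ∷ []) j ⟩
      qint· (suc u) (Rᶜ (2 ∷ [])) j - Sᶜ (2 ∷ []) (j - + u)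
        ≡⟨ cong (_- Sᶜ (2 ∷ []) (j - + u)) (qint·-cong (suc u) (Rᶜ-[c] 1) j) ⟩
      qint· (suc u) (qint· 2 δ) j - δ (j - + u)
        ≡⟨ cong (_- δ (j - + u)) (qint·-comm (suc u) 2 δ j) ⟩
      qint· (suc u) δ j + (qint· (suc u) δ (j - + 1) + + 0) - δ (j - + u)
        ≡⟨ cong (λ z → z + (qint· (suc u) δ (j - + 1) + + 0) - δ (j - + u)) (qint·-suc u δ j) ⟩
      qint· u δ j + δ (j - + u) + ((δ (j - + 1) + qint· u δ (j - + 1 - + 1)) + + 0) - δ (j - + u)
        ≡⟨ by-ring′ (qint· u δ j) (δ (j - + u)) (δ (j - + 1)) (qint· u δ (j - + 1 - + 1)) ⟩
      qint· u δ j + qint· u δ (j - + 1 - + 1) + δ (j - + 1)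
        ≡⟨ cong (λ z → qint· u δ j + z + δ (j - + 1))
                (trans (cong (qint· u δ) (i-a-b≡i-[a+b] j 1 1)) (sym (qint·-shift u 2 δ j))) ⟩
      qint· u δ j + qint· u (shift 2 δ) j + δ (j - + 1)
        ≡⟨ cong (_+ δ (j - + 1)) (sym (qint·-⊕ u δ (shift 2 δ) j)) ⟩
      A j + δ (j - + 1) ∎
      where
      by-ring′ : ∀ a b c d → a + b + ((c + d) + + 0) - b ≡ a + d + c
      by-ring′ = solve-∀

  Palindrome-Rᶜ-[2,2+w,2] : ∀ w → Palindrome (3 ℕ.+ w) (Rᶜ (2 ∷ 2 ℕ.+ w ∷ 2 ∷ []))
  Palindrome-Rᶜ-[2,2+w,2] w =
    Palindrome-ext (λ i → sym (Rᶜ-[2,2+w,2] w i))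
      (Palindrome-cast (degree w) (Palindrome-qint· 1 (Palindrome-qint· w Palindrome-1+q²)))
    where
    degree : ∀ w → 2 ℕ.+ w ℕ.+ 1 ≡ 3 ℕ.+ w
    degree = ℕ-Solver.solve-∀

  [3] : Coeffs
  [3] = qint· 3 δ

  Palindrome-[3] : Palindrome 2 [3]
  Palindrome-[3] = Palindrome-qint· 2 Palindrome-δ

  Rᶜ-[3] : ∀ i → Rᶜ (3 ∷ []) i ≡ [3] i
  Rᶜ-[3] = Rᶜ-[c] 2

  2ᵛ3 : ℕ → List ℕ
  2ᵛ3 v = replicate v 2 ++ 3 ∷ []

  RSᶜ-2ᵛ3 : ∀ v i → (Rᶜ (2ᵛ3 (suc v)) i ≡ qint· (2 ℕ.+ v) [3] i - qint· (suc v) δ (i - + 1))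
                  × (Sᶜ (2ᵛ3 (suc v)) i ≡ qint· (suc v) [3] i - qint· v δ (i - + 1))
  RSᶜ-2ᵛ3 zero i = R≡ , S≡
    where
    R≡ : Rᶜ (2 ∷ 3 ∷ []) i ≡ qint· 2 [3] i - qint· 1 δ (i - + 1)
    R≡ = trans (Rᶜ-∷ 1 (3 ∷ []) i) (cong₂ _-_ (qint·-cong 2 Rᶜ-[3] i) (sym (qint·-1 δ (i - + 1))))
    S≡ : Sᶜ (2 ∷ 3 ∷ []) i ≡ qint· 1 [3] i - qint· 0 δ (i - + 1)
    S≡ = trans (Sᶜ-∷ 2 (3 ∷ []) i) (trans (Rᶜ-[3] i) (sym (trans (+-identityʳ _) (qint·-1 [3] i))))
  RSᶜ-2ᵛ3 (suc v) i = R≡ , trans (Sᶜ-∷ 2 (2ᵛ3 (suc v)) i) (proj₁ (RSᶜ-2ᵛ3 v i))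
    where
    open ≡-Reasoning
    R≡ : Rᶜ (2ᵛ3 (2 ℕ.+ v)) i ≡ qint· (3 ℕ.+ v) [3] i - qint· (2 ℕ.+ v) δ (i - + 1)
    R≡ = begin
      Rᶜ (2 ∷ 2ᵛ3 (suc v)) i
        ≡⟨ Rᶜ-∷ 1 (2ᵛ3 (suc v)) i ⟩
      qint· 2 (Rᶜ (2ᵛ3 (suc v))) i - Sᶜ (2ᵛ3 (suc v)) (i - + 1)
        ≡⟨ cong₂ _-_ (qint·-cong 2 (λ j → proj₁ (RSᶜ-2ᵛ3 v j)) i) (proj₂ (RSᶜ-2ᵛ3 v (i - + 1))) ⟩
      qint· 2 (qint· (2 ℕ.+ v) [3] ⊕ neg (shift 1 (qint· (suc v) δ))) i - (qint· (suc v) [3] (i - + 1) - qint· v δ (i - + 1 - + 1))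
        ≡⟨ cong (_- (qint· (suc v) [3] (i - + 1) - qint· v δ (i - + 1 - + 1)))
             (trans (qint·-⊕ 2 (qint· (2 ℕ.+ v) [3]) (neg (shift 1 (qint· (suc v) δ))) i)
                    (cong (_+_ (qint· 2 (qint· (2 ℕ.+ v) [3]) i))
                          (trans (qint·-neg 2 (shift 1 (qint· (suc v) δ)) i) (cong -_ (qint·-shift 2 1 (qint· (suc v) δ) i))))) ⟩
      qint· 2 (qint· (2 ℕ.+ v) [3]) i + - qint· 2 (qint· (suc v) δ) (i - + 1) - (qint· (suc v) [3] (i - + 1) - qint· v δ (i - + 1 - + 1))
        ≡⟨ by-ring (qint· 2 (qint· (2 ℕ.+ v) [3]) i) (qint· 2 (qint· (suc v) δ) (i - + 1)) (qint· (suc v) [3] (i - + 1)) (qint· v δ (i - + 1 - + 1)) ⟩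
      (qint· 2 (qint· (2 ℕ.+ v) [3]) i - qint· (suc v) [3] (i - + 1)) - (qint· 2 (qint· (suc v) δ) (i - + 1) - qint· v δ (i - + 1 - + 1))
        ≡⟨ cong₂ _-_ ([2][1+c]-q[c]≡[2+c] (suc v) [3] i) ([2][1+c]-q[c]≡[2+c] v δ (i - + 1)) ⟩
      qint· (3 ℕ.+ v) [3] i - qint· (2 ℕ.+ v) δ (i - + 1) ∎
      where
      by-ring : ∀ a b c d → a + - b - (c - d) ≡ (a - c) - (b - d)
      by-ring = solve-∀

  Palindrome-Rᶜ-[3,3] : Palindrome 4 (Rᶜ (3 ∷ 2ᵛ3 0))
  Palindrome-Rᶜ-[3,3] =
    Palindrome-ext (λ i → sym (R≡ i)) (Palindrome-⊕ (Palindrome-qint· 2 Palindrome-[3]) (Palindrome-neg (Palindrome-shift 2 Palindrome-δ)))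
    where
    R≡ : ∀ i → Rᶜ (3 ∷ 3 ∷ []) i ≡ (qint· 3 [3] ⊕ neg (shift 2 δ)) i
    R≡ i = trans (Rᶜ-∷ 2 (3 ∷ []) i) (cong (_- δ (i - + 2)) (qint·-cong 3 Rᶜ-[3] i))

  Rᶜ-[3,2ᵛ,3] : ∀ v i → Rᶜ (3 ∷ 2ᵛ3 (suc v)) i ≡
    (qint· 3 (qint· (2 ℕ.+ v) [3]) ⊕ neg (shift 1 (qint· 2 (qint· (suc v) [3]))) ⊕ shift 3 (qint· v δ)) i
  Rᶜ-[3,2ᵛ,3] v i = begin
    Rᶜ (3 ∷ 2ᵛ3 (suc v)) i
      ≡⟨ Rᶜ-∷ 2 (2ᵛ3 (suc v)) i ⟩
    qint· 3 (Rᶜ (2ᵛ3 (suc v))) i - Sᶜ (2ᵛ3 (suc v)) (i - + 2)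
      ≡⟨ cong₂ _-_ (qint·-cong 3 (λ j → proj₁ (RSᶜ-2ᵛ3 v j)) i) (proj₂ (RSᶜ-2ᵛ3 v (i - + 2))) ⟩
    qint· 3 (qint· (2 ℕ.+ v) [3] ⊕ neg (shift 1 (qint· (suc v) δ))) i - (qint· (suc v) [3] (i - + 2) - qint· v δ (i - + 2 - + 1))
      ≡⟨ cong (_- (qint· (suc v) [3] (i - + 2) - qint· v δ (i - + 2 - + 1)))
           (trans (qint·-⊕ 3 (qint· (2 ℕ.+ v) [3]) (neg (shift 1 (qint· (suc v) δ))) i)
                  (cong (_+_ (qint· 3 (qint· (2 ℕ.+ v) [3]) i))
                        (trans (qint·-neg 3 (shift 1 (qint· (suc v) δ)) i)
                               (cong -_ (trans (qint·-shift 3 1 (qint· (suc v) δ) i) (qint·-comm 3 (suc v) δ (i - + 1))))))) ⟩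
    qint· 3 (qint· (2 ℕ.+ v) [3]) i + - qint· (suc v) [3] (i - + 1) - (qint· (suc v) [3] (i - + 2) - qint· v δ (i - + 2 - + 1))
      ≡⟨ cong₂ (λ a b → qint· 3 (qint· (2 ℕ.+ v) [3]) i + - qint· (suc v) [3] (i - + 1) - (qint· (suc v) [3] a - qint· v δ b))
           (sym (i-a-b≡i-[a+b] i 1 1)) (i-a-b≡i-[a+b] i 2 1) ⟩
    qint· 3 (qint· (2 ℕ.+ v) [3]) i + - qint· (suc v) [3] (i - + 1) - (qint· (suc v) [3] (i - + 1 - + 1) - qint· v δ (i - + 3))
      ≡⟨ by-ring (qint· 3 (qint· (2 ℕ.+ v) [3]) i) (qint· (suc v) [3] (i - + 1)) (qint· (suc v) [3] (i - + 1 - + 1)) (qint· v δ (i - + 3)) ⟩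
    qint· 3 (qint· (2 ℕ.+ v) [3]) i + - (qint· 2 (qint· (suc v) [3]) (i - + 1)) + qint· v δ (i - + 3) ∎
    where
    open ≡-Reasoning
    by-ring : ∀ a b c d → a + - b - (c - d) ≡ a + - (b + (c + + 0)) + d
    by-ring = solve-∀

  Palindrome-q³[v] : ∀ v → Palindrome (v ℕ.+ 5) (shift 3 (qint· v δ))
  Palindrome-q³[v] zero i = refl
  Palindrome-q³[v] (suc v) = Palindrome-cast (degree v) (Palindrome-shift 3 (Palindrome-qint· v Palindrome-δ))
    where
    degree : ∀ v → 0 ℕ.+ v ℕ.+ 2 ℕ.* 3 ≡ suc v ℕ.+ 5
    degree = ℕ-Solver.solve-∀

  Palindrome-Rᶜ-[3,2ᵛ,3] : ∀ v → Palindrome (4 ℕ.+ v) (Rᶜ (3 ∷ 2ᵛ3 v))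
  Palindrome-Rᶜ-[3,2ᵛ,3] zero = Palindrome-Rᶜ-[3,3]
  Palindrome-Rᶜ-[3,2ᵛ,3] (suc v) = Palindrome-ext (λ i → sym (Rᶜ-[3,2ᵛ,3] v i))
    (Palindrome-⊕ (Palindrome-⊕ (Palindrome-cast (degree₁ v) (Palindrome-qint· 2 (Palindrome-qint· (suc v) Palindrome-[3])))
                                (Palindrome-neg (Palindrome-cast (degree₂ v) (Palindrome-shift 1 (Palindrome-qint· 1 (Palindrome-qint· v Palindrome-[3]))))))
                  (Palindrome-cast (ℕP.+-comm v 5) (Palindrome-q³[v] v)))
    where
    degree₁ : ∀ v → 2 ℕ.+ suc v ℕ.+ 2 ≡ 5 ℕ.+ v
    degree₁ = ℕ-Solver.solve-∀
    degree₂ : ∀ v → 2 ℕ.+ v ℕ.+ 1 ℕ.+ 2 ℕ.* 1 ≡ 5 ℕ.+ v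
    degree₂ = ℕ-Solver.solve-∀

  2ᵛ3-≥2 : ∀ v → All (2 ≤_) (2ᵛ3 v)
  2ᵛ3-≥2 zero = s≤s (s≤s z≤n) ∷ []
  2ᵛ3-≥2 (suc v) = s≤s (s≤s z≤n) ∷ 2ᵛ3-≥2 v

module Sufficiency where

  open import Defs
  open NegativeContinuedFraction using (ceil-bounds; ceil-remainder<; ncf-step)
  open Reduction using (Reduces; 𝒮-reduces)
  open CoefficientSequences using (qint·; δ; coeff-qint; Palindrome-ext; Palindrome-cast; Palindrome-qint·; Palindrome-δ)
  open PalindromeCriterion using (coeff-ext⇒≈P; palindromic-from-coeffs)
  open Expansions using (ncf-[1+m]/m; ncf-m/1; ncf-4h/[2h+1]; ncf-4h/[2h-1])
  open WordPolynomials using (S-∷; Rᶜ-[c]; RSᶜ-2ʲ; palindromic-R; Palindrome-Rᶜ-[2,2+w,2]; 2ᵛ3; 2ᵛ3-≥2; Palindrome-Rᶜ-[3,2ᵛ,3])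
  open import Data.Nat as ℕ using (ℕ; zero; suc; _∸_; _^_; _≤_; _<_; s≤s; z≤n; >-nonZero)
  open import Data.Nat.Properties
  import Data.Nat.Tactic.RingSolver as ℕ-Solver
  open import Data.List.Relation.Unary.All using ([]; _∷_)
  open import Data.Nat.DivMod using (_/_)
  import Data.Nat.Divisibility as ℕ∣
  open import Data.Integer as ℤ using (ℤ; +_; ∣_∣; _⊖_; _+_; _*_; _-_)
  import Data.Integer.Properties as ℤP
  open import Data.Integer.Divisibility.Signed using (_∣_; ∣-refl; ∣⇒∣ᵤ; ∣m∣n⇒∣m-n; ∣m∣n⇒∣m+n; ∣n⇒∣m*n)
  open import Data.Integer.Tactic.RingSolver using (solve-∀)
  open import Data.Product using (proj₁; proj₂)
  open import Data.List using ([]; _∷_; replicate; reverse)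
  open import Data.Sum using (_⊎_; inj₁; inj₂)
  open import Data.Empty using (⊥-elim)
  open import Relation.Nullary using (¬_)
  open import Relation.Binary.Definitions using (tri<; tri≈; tri>)
  open import Relation.Binary.PropositionalEquality

  private
    m∤∣t⊖T∣ : ∀ {m t T} → t < T → T < m → ¬ (m ℕ∣.∣ ∣ t ⊖ T ∣)
    m∤∣t⊖T∣ {m} {t} {T} t<T T<m m∣ = <⇒≱ (≤-<-trans (m∸n≤m T t) T<m)
      (ℕ∣.∣⇒≤ {{>-nonZero (m<n⇒0<n∸m t<T)}} (subst (m ℕ∣.∣_) (ℤP.∣⊖∣-< t<T) m∣))

  residue-unique : ∀ {m t T} → t < m → T < m → + m ∣ + t - + T → t ≡ T
  residue-unique {m} {t} {T} t<m T<m m∣t-T with <-cmp t T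
  ... | tri≈ _ t≡T _ = t≡T
  ... | tri< t<T _ _ = ⊥-elim (m∤∣t⊖T∣ t<T T<m m∣∣t⊖T∣)
    where
    m∣∣t⊖T∣ = subst (m ℕ∣.∣_) (cong ∣_∣ (ℤP.[+m]-[+n]≡m⊖n t T)) (∣⇒∣ᵤ m∣t-T)
  ... | tri> _ _ T<t = ⊥-elim (m∤∣t⊖T∣ T<t t<m m∣∣T⊖t∣)
    where
    m∣∣T⊖t∣ = subst (m ℕ∣.∣_) (trans (cong ∣_∣ (ℤP.[+m]-[+n]≡m⊖n t T)) (ℤP.∣m⊖n∣≡∣n⊖m∣ t T)) (∣⇒∣ᵤ m∣t-T)

  -- The expansion of r/m (r ≡ a mod m) starts with c = ⌈r/m⌉ and continues with m/t, where t = c m − r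
  -- is the residue of −a; and 𝒮 of a fraction is ℛ of the tail of its expansion.
  𝒮≡R-ncf : ∀ m′ a T → 1 ≤ m′ → 0 < T → T < suc m′ → + (suc m′) ∣ a + + T →
            𝒮 a (suc m′) ≡ proj₁ (RSvec (ncf m′ (suc m′) T))
  𝒮≡R-ncf m′ a T 1≤m′ 0<T T<m m∣a+T = begin
    𝒮 a m                               ≡⟨ S≡ ⟩
    proj₂ (RSvec (ncf (suc m′) r m))     ≡⟨ cong (λ w → proj₂ (RSvec w)) (ncf-step m′ r m′ refl cm≢r) ⟩
    proj₂ (RSvec (c ∷ ncf m′ m t))       ≡⟨ S-∷ c (ncf m′ m t) ⟩
    proj₁ (RSvec (ncf m′ m t))           ≡⟨ cong (λ u → proj₁ (RSvec (ncf m′ m u))) t≡T ⟩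
    proj₁ (RSvec (ncf m′ m T))           ∎
    where
    open ≡-Reasoning
    m = suc m′
    a≢0 : a ≢ + 0
    a≢0 refl = <⇒≱ T<m (ℕ∣.∣⇒≤ {{>-nonZero 0<T}} (∣⇒∣ᵤ m∣a+T))
    open Reduces (𝒮-reduces m a (s≤s 1≤m′) a≢0)
    c = (r ℕ.+ m′) / m
    t = c ℕ.* m ∸ r
    r≤cm = proj₁ (ceil-bounds r m′)
    t<m : t < m
    t<m = ceil-remainder< r m′
    t-T≡ : + t - + T ≡ (+ c - + k) * + m - (a + + T)
    t-T≡ = begin
      + t - + T
        ≡⟨ cong (_- + T) (sym (trans (ℤP.[+m]-[+n]≡m⊖n (c ℕ.* m) r) (ℤP.⊖-≥ r≤cm))) ⟩
      + (c ℕ.* m) - + r - + T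
        ≡⟨ cong₂ (λ u v → u - v - + T) (ℤP.pos-* c m) (trans r≡ (cong (_+_ a) (ℤP.pos-* k m))) ⟩
      + c * + m - (a + + k * + m) - + T
        ≡⟨ by-ring (+ c) (+ k) (+ m) a (+ T) ⟩
      (+ c - + k) * + m - (a + + T) ∎
      where
      by-ring : ∀ c k m a T → c * m - (a + k * m) - T ≡ (c - k) * m - (a + T)
      by-ring = solve-∀
    t≡T : t ≡ T
    t≡T = residue-unique t<m T<m
            (subst (+ m ∣_) (sym t-T≡) (∣m∣n⇒∣m-n (∣n⇒∣m*n (+ c - + k) (∣-refl {+ m})) m∣a+T))
    cm≢r : c ℕ.* m ≢ r
    cm≢r cm≡r = <⇒≢ 0<T (trans (sym (trans (cong (_∸ r) cm≡r) (n∸n≡0 r))) t≡T)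

  palindromic-qint : ∀ m → Palindromic (qint (suc m))
  palindromic-qint m = palindromic-from-coeffs (qint (suc m)) m
    (Palindrome-ext {F = qint· (suc m) δ} (λ i → sym (coeff-qint (suc m) i))
                    (Palindrome-cast (+-identityˡ m) (Palindrome-qint· m Palindrome-δ)))
    (λ ())

  ≈P-qint⇒palindromic : ∀ m f → 1 ≤ m → f ≈P qint m → Palindromic f
  ≈P-qint⇒palindromic (suc m) f _ f≈[m] = subst (λ g → reverse g ≡ g) (sym f≈[m]) (palindromic-qint m)

  a≡±1⇒𝒮≈[m] : ∀ m a → 2 ≤ m → (+ m ∣ a - + 1) ⊎ (+ m ∣ a + + 1) → 𝒮 a m ≈P qint m
  a≡±1⇒𝒮≈[m] (suc m′) a (s≤s 1≤m′) (inj₁ m∣a-1) = begin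
    strip (𝒮 a (suc m′))
      ≡⟨ cong strip (𝒮≡R-ncf m′ a m′ 1≤m′ 1≤m′ ≤-refl m∣a+[m-1]) ⟩
    strip (proj₁ (RSvec (ncf m′ (suc m′) m′)))
      ≡⟨ cong (λ w → strip (proj₁ (RSvec w))) (ncf-[1+m]/m m′ m′ ≤-refl) ⟩
    strip (proj₁ (RSvec (replicate m′ 2)))
      ≡⟨ coeff-ext⇒≈P (proj₁ (RSvec (replicate m′ 2))) (qint (suc m′))
                      (λ n → trans (proj₁ (RSᶜ-2ʲ m′ (+ n))) (sym (coeff-qint (suc m′) (+ n)))) ⟩
    strip (qint (suc m′)) ∎
    where
    open ≡-Reasoning
    by-ring : ∀ a m′ → a - + 1 + (+ 1 + m′) ≡ a + m′
    by-ring = solve-∀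
    m∣a+[m-1] : + (suc m′) ∣ a + + m′
    m∣a+[m-1] = subst (+ (suc m′) ∣_) (by-ring a (+ m′)) (∣m∣n⇒∣m+n m∣a-1 ∣-refl)
  a≡±1⇒𝒮≈[m] (suc (suc m″)) a (s≤s 1≤m′) (inj₂ m∣a+1) = begin
    strip (𝒮 a (2 ℕ.+ m″))
      ≡⟨ cong strip (𝒮≡R-ncf (suc m″) a 1 1≤m′ ≤-refl (s≤s (s≤s z≤n)) m∣a+1) ⟩
    strip (proj₁ (RSvec (ncf (suc m″) (2 ℕ.+ m″) 1)))
      ≡⟨ cong (λ w → strip (proj₁ (RSvec w))) (ncf-m/1 m″ (2 ℕ.+ m″)) ⟩
    strip (proj₁ (RSvec (2 ℕ.+ m″ ∷ [])))
      ≡⟨ coeff-ext⇒≈P (proj₁ (RSvec (2 ℕ.+ m″ ∷ []))) (qint (2 ℕ.+ m″))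
                      (λ n → trans (Rᶜ-[c] (suc m″) (+ n)) (sym (coeff-qint (2 ℕ.+ m″) (+ n)))) ⟩
    strip (qint (2 ℕ.+ m″)) ∎
    where open ≡-Reasoning

  a≡±1⇒palindromic : ∀ m a → 2 ≤ m → (+ m ∣ a - + 1) ⊎ (+ m ∣ a + + 1) → Palindromic (𝒮 a m)
  a≡±1⇒palindromic m a 2≤m ±1 = ≈P-qint⇒palindromic m (𝒮 a m) (≤-trans (s≤s z≤n) 2≤m) (a≡±1⇒𝒮≈[m] m a 2≤m ±1)

  private
    ≤-by : ∀ {x y} d → x ℕ.+ d ≡ y → x ≤ y
    ≤-by {x} d x+d≡y = subst (x ≤_) x+d≡y (m≤m+n x d)

  -- Here −a ≡ 2h + 1 (mod 4h), and 4h/(2h + 1) = [2, h + 1, 2].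
  a≡2h-1⇒palindromic : ∀ h a → 1 ≤ h → + (4 ℕ.* h) ∣ a - (+ (2 ℕ.* h) - + 1) → Palindromic (𝒮 a (4 ℕ.* h))
  a≡2h-1⇒palindromic h@(suc w) a _ m∣a-[2h-1] = subst Palindromic (sym 𝒮≡R)
    (palindromic-R (2 ∷ 2 ℕ.+ w ∷ 2 ∷ []) (3 ℕ.+ w) (≤-refl ∷ s≤s (s≤s z≤n) ∷ ≤-refl ∷ []) (Palindrome-Rᶜ-[2,2+w,2] w))
    where
    m′ = w ℕ.+ 3 ℕ.* h
    T = 1 ℕ.+ 2 ℕ.* h
    m∣a+T : + (4 ℕ.* h) ∣ a + + T
    m∣a+T = subst (+ (4 ℕ.* h) ∣_) a+T≡ (∣m∣n⇒∣m+n m∣a-[2h-1] ∣-refl)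
      where
      by-ring : ∀ a h → a - (+ 2 * h - + 1) + + 4 * h ≡ a + (+ 1 + + 2 * h)
      by-ring = solve-∀
      a+T≡ : a - (+ (2 ℕ.* h) - + 1) + + (4 ℕ.* h) ≡ a + + T
      a+T≡ = trans (cong₂ (λ x y → a - (x - + 1) + y) (ℤP.pos-* 2 h) (ℤP.pos-* 4 h))
                   (trans (by-ring a (+ h)) (cong (λ z → a + (+ 1 + z)) (sym (ℤP.pos-* 2 h))))
    m′≡ : ∀ w → w ℕ.+ 3 ℕ.* suc w ≡ 3 ℕ.+ 4 ℕ.* w
    m′≡ = ℕ-Solver.solve-∀
    T<m : ∀ w → suc (1 ℕ.+ 2 ℕ.* suc w) ℕ.+ 2 ℕ.* w ≡ 4 ℕ.* suc w
    T<m = ℕ-Solver.solve-∀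
    𝒮≡R : 𝒮 a (4 ℕ.* h) ≡ proj₁ (RSvec (2 ∷ 2 ℕ.+ w ∷ 2 ∷ []))
    𝒮≡R = begin
      𝒮 a (4 ℕ.* h)
        ≡⟨ 𝒮≡R-ncf m′ a T (≤-trans (s≤s z≤n) (m≤n+m (3 ℕ.* h) w)) (s≤s z≤n) (≤-by (2 ℕ.* w) (T<m w)) m∣a+T ⟩
      proj₁ (RSvec (ncf m′ (4 ℕ.* h) T))
        ≡⟨ cong (λ f → proj₁ (RSvec (ncf f (4 ℕ.* h) T))) (m′≡ w) ⟩
      proj₁ (RSvec (ncf (3 ℕ.+ 4 ℕ.* w) (4 ℕ.* h) T))
        ≡⟨ cong (λ u → proj₁ (RSvec u)) (ncf-4h/[2h+1] w (4 ℕ.* w)) ⟩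
      proj₁ (RSvec (2 ∷ 2 ℕ.+ w ∷ 2 ∷ [])) ∎
      where open ≡-Reasoning

  -- Here −a ≡ 2h − 1 (mod 4h), and 4h/(2h − 1) = [3, 2, …, 2, 3].
  a≡2h+1⇒palindromic : ∀ h a → 2 ≤ h → + (4 ℕ.* h) ∣ a - (+ (2 ℕ.* h) + + 1) → Palindromic (𝒮 a (4 ℕ.* h))
  a≡2h+1⇒palindromic (suc zero) a (s≤s ()) _
  a≡2h+1⇒palindromic h@(suc (suc v)) a _ m∣a-[2h+1] = subst Palindromic (sym 𝒮≡R)
    (palindromic-R (3 ∷ 2ᵛ3 v) (4 ℕ.+ v) (s≤s (s≤s z≤n) ∷ 2ᵛ3-≥2 v) (Palindrome-Rᶜ-[3,2ᵛ,3] v))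
    where
    m′ = suc v ℕ.+ 3 ℕ.* h
    T = 3 ℕ.+ 2 ℕ.* v
    m∣a+T : + (4 ℕ.* h) ∣ a + + T
    m∣a+T = subst (+ (4 ℕ.* h) ∣_) a+T≡ (∣m∣n⇒∣m+n m∣a-[2h+1] ∣-refl)
      where
      by-ring : ∀ a v → a - (+ 2 * (+ 2 + v) + + 1) + + 4 * (+ 2 + v) ≡ a + (+ 3 + + 2 * v)
      by-ring = solve-∀
      a+T≡ : a - (+ (2 ℕ.* h) + + 1) + + (4 ℕ.* h) ≡ a + (+ 3 + + (2 ℕ.* v))
      a+T≡ = trans (cong₂ (λ x y → a - (x + + 1) + y) (ℤP.pos-* 2 h) (ℤP.pos-* 4 h))
                   (trans (by-ring a (+ v)) (cong (λ z → a + (+ 3 + z)) (sym (ℤP.pos-* 2 v))))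
    m′≡ : ∀ v → suc v ℕ.+ 3 ℕ.* (2 ℕ.+ v) ≡ 2 ℕ.+ v ℕ.+ (5 ℕ.+ 3 ℕ.* v)
    m′≡ = ℕ-Solver.solve-∀
    T<m : ∀ v → suc (3 ℕ.+ 2 ℕ.* v) ℕ.+ (4 ℕ.+ 2 ℕ.* v) ≡ 4 ℕ.* (2 ℕ.+ v)
    T<m = ℕ-Solver.solve-∀
    𝒮≡R : 𝒮 a (4 ℕ.* h) ≡ proj₁ (RSvec (3 ∷ 2ᵛ3 v))
    𝒮≡R = begin
      𝒮 a (4 ℕ.* h)
        ≡⟨ 𝒮≡R-ncf m′ a T (s≤s z≤n) (s≤s z≤n) (≤-by (4 ℕ.+ 2 ℕ.* v) (T<m v)) m∣a+T ⟩
      proj₁ (RSvec (ncf m′ (4 ℕ.* h) T))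
        ≡⟨ cong (λ f → proj₁ (RSvec (ncf f (4 ℕ.* h) T))) (m′≡ v) ⟩
      proj₁ (RSvec (ncf (2 ℕ.+ v ℕ.+ (5 ℕ.+ 3 ℕ.* v)) (4 ℕ.* h) T))
        ≡⟨ cong (λ u → proj₁ (RSvec u)) (ncf-4h/[2h-1] v (5 ℕ.+ 3 ℕ.* v)) ⟩
      proj₁ (RSvec (3 ∷ 2ᵛ3 v)) ∎
      where open ≡-Reasoning

  p≤p^[1+k] : ∀ p k .{{_ : ℕ.NonZero p}} → p ≤ p ^ suc k
  p≤p^[1+k] p k = m≤m*n p (p ^ k) {{m^n≢0 p k}}

  a≡±1,2ᵏ⁺¹±1⇒palindromic : ∀ k a →
    (+ (2 ^ (2 ℕ.+ k)) ∣ a - + 1) ⊎ (+ (2 ^ (2 ℕ.+ k)) ∣ a + + 1)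
    ⊎ (+ (2 ^ (2 ℕ.+ k)) ∣ a - (+ (2 ^ suc k) + + 1)) ⊎ (+ (2 ^ (2 ℕ.+ k)) ∣ a - (+ (2 ^ suc k) - + 1)) →
    Palindromic (𝒮 a (2 ^ (2 ℕ.+ k)))
  a≡±1,2ᵏ⁺¹±1⇒palindromic k a (inj₁ N∣a-1) = a≡±1⇒palindromic _ a (p≤p^[1+k] 2 (suc k)) (inj₁ N∣a-1)
  a≡±1,2ᵏ⁺¹±1⇒palindromic k a (inj₂ (inj₁ N∣a+1)) = a≡±1⇒palindromic _ a (p≤p^[1+k] 2 (suc k)) (inj₂ N∣a+1)
  -- For k = 0 the classes 2 ± 1 are just ∓1 modulo 4.
  a≡±1,2ᵏ⁺¹±1⇒palindromic zero a (inj₂ (inj₂ (inj₁ 4∣a-3))) =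
    a≡±1⇒palindromic 4 a (s≤s (s≤s z≤n)) (inj₂ (subst (+ 4 ∣_) (by-ring a) (∣m∣n⇒∣m+n 4∣a-3 ∣-refl)))
    where
    by-ring : ∀ a → a - + 3 + + 4 ≡ a + + 1
    by-ring = solve-∀
  a≡±1,2ᵏ⁺¹±1⇒palindromic zero a (inj₂ (inj₂ (inj₂ 4∣a-1))) = a≡±1⇒palindromic 4 a (s≤s (s≤s z≤n)) (inj₁ 4∣a-1)
  a≡±1,2ᵏ⁺¹±1⇒palindromic (suc j) a (inj₂ (inj₂ N∣a-[2h±1])) =
    subst (λ m → Palindromic (𝒮 a m)) (sym 2[2h]≡4h) (a≡2h±1⇒palindromic N∣a-[2h±1])
    where
    h = 2 ^ suc j
    2≤h = p≤p^[1+k] 2 j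
    2[2h]≡4h : 2 ℕ.* (2 ℕ.* h) ≡ 4 ℕ.* h
    2[2h]≡4h = sym (*-assoc 2 2 h)
    cast : ∀ {x} → + (2 ℕ.* (2 ℕ.* h)) ∣ x → + (4 ℕ.* h) ∣ x
    cast {x} = subst (λ m → + m ∣ x) 2[2h]≡4h
    a≡2h±1⇒palindromic : (+ (2 ℕ.* (2 ℕ.* h)) ∣ a - (+ (2 ℕ.* h) + + 1)) ⊎ (+ (2 ℕ.* (2 ℕ.* h)) ∣ a - (+ (2 ℕ.* h) - + 1)) →
                         Palindromic (𝒮 a (4 ℕ.* h))
    a≡2h±1⇒palindromic (inj₁ m∣a-[2h+1]) = a≡2h+1⇒palindromic h a 2≤h (cast m∣a-[2h+1])
    a≡2h±1⇒palindromic (inj₂ m∣a-[2h-1]) = a≡2h-1⇒palindromic h a (≤-trans (s≤s z≤n) 2≤h) (cast m∣a-[2h-1])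

open import Defs
open import Data.Nat as ℕ using (ℕ; _^_; _≥_; _%_)
open import Data.Nat.Primality using (Prime)
open import Data.Integer as ℤ using (ℤ; +_; _-_; _+_)
open import Data.Integer.Divisibility using (_∣_)
open import Data.Integer.GCD using (gcd)
open import Data.Product using (_×_)
open import Data.Sum using (_⊎_)
open import Function.Bundles using (_⇔_)
open import Relation.Binary.PropositionalEquality using (_≡_)

open Necessity using (palindromic⇒m∣a²-1)
open SquareRootsOfOne using (p^n∣a²-1⇒a≡±1; 2^[2+k]∣a²-1⇒a≡±1,2^[1+k]±1)
open Sufficiency using (a≡±1⇒𝒮≈[m]; ≈P-qint⇒palindromic; a≡±1,2ᵏ⁺¹±1⇒palindromic; p≤p^[1+k])
open import Data.Nat using (zero; suc; _≤_; s≤s; z≤n)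
open import Data.Nat.Properties using (≤-trans)
open import Data.Nat.Coprimality using (Coprime; gcd≡1⇒coprime)
open import Data.Nat.Primality using (prime⇒nonZero; prime⇒nonTrivial)
open import Data.Integer.Properties using (+-injective)
open import Data.Integer.Divisibility.Signed using (∣ᵤ⇒∣; ∣⇒∣ᵤ)
open import Data.Product using (_,_)
open import Data.Sum using (map)
open import Function using (_∘_)
open import Function.Bundles using (mk⇔)

private
  gcd≡1⇒coprime′ : ∀ a m → gcd a (+ m) ≡ + 1 → Coprime ℤ.∣ a ∣ m
  gcd≡1⇒coprime′ a m gcd≡1 = gcd≡1⇒coprime (+-injective gcd≡1)

palindromic⇔a≡±1⇔𝒮≈[pⁿ] : ∀ p n a → Prime p → p % 2 ≡ 1 → n ≥ 1 → gcd a (+ (p ^ n)) ≡ + 1 →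
  (Palindromic (𝒮 a (p ^ n)) ⇔ ((+ (p ^ n) ∣ a - + 1) ⊎ (+ (p ^ n) ∣ a + + 1)))
  × (((+ (p ^ n) ∣ a - + 1) ⊎ (+ (p ^ n) ∣ a + + 1)) ⇔ (𝒮 a (p ^ n) ≈P qint (p ^ n)))
palindromic⇔a≡±1⇔𝒮≈[pⁿ] p n@(suc k) a p-prime p-odd _ gcd≡1 =
  mk⇔ palindromic⇒±1 (≈[m]⇒palindromic ∘ ±1⇒≈[m]) , mk⇔ ±1⇒≈[m] (palindromic⇒±1 ∘ ≈[m]⇒palindromic)
  where
  instance _ = prime⇒nonZero p-prime
  m = p ^ n
  2≤m : 2 ≤ m
  2≤m = ≤-trans (ℕ.nonTrivial⇒n>1 p {{prime⇒nonTrivial p-prime}}) (p≤p^[1+k] p k)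
  ±1 = (+ m ∣ a - + 1) ⊎ (+ m ∣ a + + 1)
  palindromic⇒±1 : Palindromic (𝒮 a m) → ±1
  palindromic⇒±1 = map ∣⇒∣ᵤ ∣⇒∣ᵤ ∘ p^n∣a²-1⇒a≡±1 p-prime p-odd n a
                 ∘ palindromic⇒m∣a²-1 m a 2≤m (gcd≡1⇒coprime′ a m gcd≡1)
  ±1⇒≈[m] : ±1 → 𝒮 a m ≈P qint m
  ±1⇒≈[m] = a≡±1⇒𝒮≈[m] m a 2≤m ∘ map ∣ᵤ⇒∣ ∣ᵤ⇒∣
  ≈[m]⇒palindromic : 𝒮 a m ≈P qint m → Palindromic (𝒮 a m)
  ≈[m]⇒palindromic = ≈P-qint⇒palindromic m (𝒮 a m) (≤-trans (s≤s z≤n) 2≤m)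

palindromic⇔a≡±1,2ⁿ⁻¹±1 : ∀ n a → n ≥ 2 → gcd a (+ (2 ^ n)) ≡ + 1 →
  (Palindromic (𝒮 a (2 ^ n)) ⇔
    ((+ (2 ^ n) ∣ (a - + 1)) ⊎ (+ (2 ^ n) ∣ (a + + 1))
     ⊎ (+ (2 ^ n) ∣ (a - (+ (2 ^ (n ℕ.∸ 1)) + + 1))) ⊎ (+ (2 ^ n) ∣ (a - (+ (2 ^ (n ℕ.∸ 1)) - + 1)))))
palindromic⇔a≡±1,2ⁿ⁻¹±1 (suc zero) a (s≤s ()) _
palindromic⇔a≡±1,2ⁿ⁻¹±1 n@(suc (suc k)) a _ gcd≡1 =
  mk⇔ (map ∣⇒∣ᵤ (map ∣⇒∣ᵤ (map ∣⇒∣ᵤ ∣⇒∣ᵤ)) ∘ 2^[2+k]∣a²-1⇒a≡±1,2^[1+k]±1 k a coprime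
         ∘ palindromic⇒m∣a²-1 (2 ^ n) a (p≤p^[1+k] 2 (suc k)) coprime)
      (a≡±1,2ᵏ⁺¹±1⇒palindromic k a ∘ map ∣ᵤ⇒∣ (map ∣ᵤ⇒∣ (map ∣ᵤ⇒∣ ∣ᵤ⇒∣)))
  where
  coprime = gcd≡1⇒coprime′ a (2 ^ n) gcd≡1

corollary3p7 :
    ((p n : ℕ) (a : ℤ) → Prime p → p % 2 ≡ 1 → n ≥ 1 →
      gcd a (+ (p ^ n)) ≡ + 1 →
      (Palindromic (𝒮 a (p ^ n)) ⇔ ((+ (p ^ n) ∣ (a - + 1)) ⊎ (+ (p ^ n) ∣ (a + + 1))))
      × (((+ (p ^ n) ∣ (a - + 1)) ⊎ (+ (p ^ n) ∣ (a + + 1))) ⇔ (𝒮 a (p ^ n) ≈P qint (p ^ n))))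
    ×
    ((n : ℕ) (a : ℤ) → n ≥ 2 → gcd a (+ (2 ^ n)) ≡ + 1 →
      (Palindromic (𝒮 a (2 ^ n)) ⇔
        ((+ (2 ^ n) ∣ (a - + 1)) ⊎ (+ (2 ^ n) ∣ (a + + 1))
         ⊎ (+ (2 ^ n) ∣ (a - (+ (2 ^ (n ℕ.∸ 1)) + + 1))) ⊎ (+ (2 ^ n) ∣ (a - (+ (2 ^ (n ℕ.∸ 1)) - + 1))))))
corollary3p7 = palindromic⇔a≡±1⇔𝒮≈[pⁿ] , palindromic⇔a≡±1,2ⁿ⁻¹±1
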